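{- Let $\sigma$ and $\sigma'=\exists y\,(\mathsf{wb}(y)\wedge\sigma_0'(y))$ be 1-$\Sigma_1$-sentences and let $\rho$ be a $\Sigma_1$-sentence. Then: (a) if $\mathbb{N}\models\sigma\leq\sigma'$ and $\mathsf{R}_0\vdash\rho\leftrightarrow(\sigma'<\sigma)$, then $[\rho]$ is inconsistent; (b) if $\mathbb{N}\models\sigma<\sigma'$ and $\mathsf{R}_0\vdash\rho\leftrightarrow(\sigma'\leq\sigma)$, then $[\rho]$ is inconsistent.
   Context: $\mathbb{L}_{\sf a}=\{0,\mathsf{S},+,\times,\leq\}$ with $\leq$ primitive; $x<y$ abbreviates $x\leq y\wedge x\neq y$; $\overline{n}$ are numerals. $\mathsf{R}_0$ has axioms, for all $m,n\in\omega$: $\overline{m}+\overline{n}=\overline{m+n}$; $\overline{m}\times\overline{n}=\overline{m\times n}$; $\overline{m}\neq\overline{n}$ if $m\neq n$; $\forall x\,(x\leq\overline{n}\to\bigvee_{i\leq n}x=\overline{i})$; $\overline{m}\leq\overline{n}$ if $m\leq n$. A ($1$-)$\Sigma_1$-sentence is $\exists\vec x\,\delta$ (resp. $\exists x\,\delta(x)$) with $\delta$ bounded. $\mathsf{wb}(x)$ is $0\leq x\wedge\forall y<x\;\mathsf{S}y\leq x$. For $\varphi=\exists x\,\varphi_0(x)$, $\psi=\exists y\,\psi_0(y)$: $\varphi\leq\psi:=\exists x(\varphi_0(x)\wedge\forall y<x\,\neg\psi_0(y))$, $\varphi<\psi:=\exists x(\varphi_0(x)\wedge\forall y\leq x\,\neg\psi_0(y))$.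 A pure $\Delta_0$-formula is a bounded formula whose atomic $\leq$-formulas relate two variables and whose atomic equations have the forms $x_0=x_1$, $0=x_0$, $\mathsf{S}x_0=x_1$, $x_0+x_1=x_2$, $x_0\times x_1=x_2$. For the $\Sigma_1$-sentence $\rho$, $\rho^\bullet=\exists x\,\rho_0(x)$ is a pure 1-$\Sigma_1$-sentence (with $\rho_0$ pure $\Delta_0$), found effectively, with $\mathbb{N}\models\rho\leftrightarrow\rho^\bullet$ and $\rho^\bullet\to\rho$ logically valid; then $[\rho]:=\exists x\,(\mathsf{cert}(x)\wedge\rho_0(x))$, where $\mathsf{cert}(v)$ is the conjunction of: $0\leq v$; $\forall x<v\;\mathsf{S}x\leq v$; $\forall x(x\leq 0\leftrightarrow x=0)$; $\forall x<v\,\forall y(y\leq\mathsf{S}x\leftrightarrow(y\leq x\vee y=\mathsf{S}x))$; $\forall x,y,z\leq v\;\mathsf{S}((x\times y)+z)\neq0$; $\forall x,y,z,w\leq v(\mathsf{S}((x\times y)+z)=\mathsf{S}w\to(x\times y)+z=w)$; $\forall x,y\leq v\;(x\times y)+0=x\times y$; $\forall x,y,z\leq v\;(x\times y)+\mathsf{S}z=\mathsf{S}((x\times y)+z)$; $\forall x\leq v\;x\times0=0$; $\forall x,y\leq v\;x\times\mathsf{S}y=(x\times y)+x$. -}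

module Defs where

open import Data.Nat using (ℕ; zero; suc; _+_; _*_; _≤_)
open import Data.Fin using (Fin; zero; suc; #_)
open import Data.List using (List; []; _∷_; map)
open import Data.List.Relation.Unary.All using (All)
open import Data.List.Membership.Propositional using (_∈_)
open import Data.Product using (Σ; _×_; _,_)
open import Data.Sum using (_⊎_)
open import Data.Empty using (⊥)
open import Relation.Binary.PropositionalEquality using (_≡_; _≢_)

-- Syntax of L_a = {0, S, +, ×, ≤} (de Bruijn; Term n / Formula n have
-- at most n free variables, var zero = innermost bound variable)

data Term (n : ℕ) : Set where
  var  : Fin n → Term n
  `0   : Term n
  `S   : Term n → Term n
  _`+_ : Term n → Term n → Term n
  _`×_ : Term n → Term n → Term n

infixl 7 _`×_
infixl 6 _`+_
infix 4 _≐_ _≼_ _≺_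
infixr 3 _∧'_
infixr 2 _∨'_
infixr 1 _⇒_ _⇔'_

data Formula (n : ℕ) : Set where
  ⊥'   : Formula n
  _≐_  : Term n → Term n → Formula n
  _≼_  : Term n → Term n → Formula n
  _⇒_  : Formula n → Formula n → Formula n
  _∧'_ : Formula n → Formula n → Formula n
  _∨'_ : Formula n → Formula n → Formula n
  ∀'   : Formula (suc n) → Formula n
  ∃'   : Formula (suc n) → Formula n

¬'_ : ∀ {n} → Formula n → Formula n
¬' φ = φ ⇒ ⊥'

_⇔'_ : ∀ {n} → Formula n → Formula n → Formula n
φ ⇔' ψ = (φ ⇒ ψ) ∧' (ψ ⇒ φ)

_≺_ : ∀ {n} → Term n → Term n → Formula n
s ≺ t = (s ≼ t) ∧' ¬' (s ≐ t)

num : ∀ {n} → ℕ → Term n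
num zero    = `0
num (suc k) = `S (num k)

liftR : ∀ {m n} → (Fin m → Fin n) → Fin (suc m) → Fin (suc n)
liftR r zero    = zero
liftR r (suc i) = suc (r i)

renT : ∀ {m n} → (Fin m → Fin n) → Term m → Term n
renT r (var i)  = var (r i)
renT r `0       = `0
renT r (`S t)   = `S (renT r t)
renT r (s `+ t) = renT r s `+ renT r t
renT r (s `× t) = renT r s `× renT r t

renF : ∀ {m n} → (Fin m → Fin n) → Formula m → Formula n
renF r ⊥'       = ⊥'
renF r (s ≐ t)  = renT r s ≐ renT r t
renF r (s ≼ t)  = renT r s ≼ renT r t
renF r (φ ⇒ ψ)  = renF r φ ⇒ renF r ψ
renF r (φ ∧' ψ) = renF r φ ∧' renF r ψ
renF r (φ ∨' ψ) = renF r φ ∨' renF r ψ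
renF r (∀' φ)   = ∀' (renF (liftR r) φ)
renF r (∃' φ)   = ∃' (renF (liftR r) φ)

wkT : ∀ {n} → Term n → Term (suc n)
wkT = renT suc

wkF : ∀ {n} → Formula n → Formula (suc n)
wkF = renF suc

liftS : ∀ {m n} → (Fin m → Term n) → Fin (suc m) → Term (suc n)
liftS s zero    = var zero
liftS s (suc i) = wkT (s i)

subT : ∀ {m n} → (Fin m → Term n) → Term m → Term n
subT s (var i)  = s i
subT s `0       = `0
subT s (`S t)   = `S (subT s t)
subT s (t `+ u) = subT s t `+ subT s u
subT s (t `× u) = subT s t `× subT s u

subF : ∀ {m n} → (Fin m → Term n) → Formula m → Formula n
subF s ⊥'       = ⊥'
subF s (t ≐ u)  = subT s t ≐ subT s u
subF s (t ≼ u)  = subT s t ≼ subT s u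
subF s (φ ⇒ ψ)  = subF s φ ⇒ subF s ψ
subF s (φ ∧' ψ) = subF s φ ∧' subF s ψ
subF s (φ ∨' ψ) = subF s φ ∨' subF s ψ
subF s (∀' φ)   = ∀' (subF (liftS s) φ)
subF s (∃' φ)   = ∃' (subF (liftS s) φ)

sub0 : ∀ {n} → Term n → Fin (suc n) → Term n
sub0 t zero    = t
sub0 t (suc i) = var i

_[_] : ∀ {n} → Formula (suc n) → Term n → Formula n
φ [ t ] = subF (sub0 t) φ

∀≤ ∃≤ ∀< ∃< : ∀ {n} → Term n → Formula (suc n) → Formula n
∀≤ t φ = ∀' ((var zero ≼ wkT t) ⇒ φ)
∃≤ t φ = ∃' ((var zero ≼ wkT t) ∧' φ)
∀< t φ = ∀' ((var zero ≺ wkT t) ⇒ φ)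
∃< t φ = ∃' ((var zero ≺ wkT t) ∧' φ)

data Bounded {n : ℕ} : Formula n → Set where
  b⊥  : Bounded ⊥'
  b≐  : ∀ s t → Bounded (s ≐ t)
  b≼  : ∀ s t → Bounded (s ≼ t)
  b⇒  : ∀ {φ ψ} → Bounded φ → Bounded ψ → Bounded (φ ⇒ ψ)
  b∧  : ∀ {φ ψ} → Bounded φ → Bounded ψ → Bounded (φ ∧' ψ)
  b∨  : ∀ {φ ψ} → Bounded φ → Bounded ψ → Bounded (φ ∨' ψ)
  b∀≤ : ∀ t {φ} → Bounded φ → Bounded (∀≤ t φ)
  b∃≤ : ∀ t {φ} → Bounded φ → Bounded (∃≤ t φ)
  b∀< : ∀ t {φ} → Bounded φ → Bounded (∀< t φ)
  b∃< : ∀ t {φ} → Bounded φ → Bounded (∃< t φ)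

data PureΔ₀ {n : ℕ} : Formula n → Set where
  p⊥  : PureΔ₀ ⊥'
  p≼  : ∀ i j → PureΔ₀ (var i ≼ var j)
  p≐  : ∀ i j → PureΔ₀ (var i ≐ var j)
  p0  : ∀ i → PureΔ₀ (`0 ≐ var i)
  pS  : ∀ i j → PureΔ₀ (`S (var i) ≐ var j)
  p+  : ∀ i j k → PureΔ₀ (var i `+ var j ≐ var k)
  p×  : ∀ i j k → PureΔ₀ (var i `× var j ≐ var k)
  p⇒  : ∀ {φ ψ} → PureΔ₀ φ → PureΔ₀ ψ → PureΔ₀ (φ ⇒ ψ)
  p∧  : ∀ {φ ψ} → PureΔ₀ φ → PureΔ₀ ψ → PureΔ₀ (φ ∧' ψ)
  p∨  : ∀ {φ ψ} → PureΔ₀ φ → PureΔ₀ ψ → PureΔ₀ (φ ∨' ψ)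
  p∀≤ : ∀ i {φ} → PureΔ₀ φ → PureΔ₀ (∀≤ (var i) φ)
  p∃≤ : ∀ i {φ} → PureΔ₀ φ → PureΔ₀ (∃≤ (var i) φ)
  p∀< : ∀ i {φ} → PureΔ₀ φ → PureΔ₀ (∀< (var i) φ)
  p∃< : ∀ i {φ} → PureΔ₀ φ → PureΔ₀ (∃< (var i) φ)

data IsΣ₁ {n : ℕ} : Formula n → Set where
  σbnd : ∀ {φ} → Bounded φ → IsΣ₁ φ
  σ∃   : ∀ {φ} → IsΣ₁ φ → IsΣ₁ (∃' φ)

-- A 1-Σ₁-sentence ∃x δ(x) is represented by its matrix δ : Formula 1
-- (with Bounded δ); the sentence itself is ∃' δ.

_∷ₑ_ : ∀ {n} → ℕ → (Fin n → ℕ) → Fin (suc n) → ℕ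
(k ∷ₑ e) zero    = k
(k ∷ₑ e) (suc i) = e i

evalT : ∀ {n} → (Fin n → ℕ) → Term n → ℕ
evalT e (var i)  = e i
evalT e `0       = 0
evalT e (`S t)   = suc (evalT e t)
evalT e (s `+ t) = evalT e s + evalT e t
evalT e (s `× t) = evalT e s * evalT e t

sat : ∀ {n} → (Fin n → ℕ) → Formula n → Set
sat e ⊥'       = ⊥
sat e (s ≐ t)  = evalT e s ≡ evalT e t
sat e (s ≼ t)  = evalT e s ≤ evalT e t
sat e (φ ⇒ ψ)  = sat e φ → sat e ψ
sat e (φ ∧' ψ) = sat e φ × sat e ψ
sat e (φ ∨' ψ) = sat e φ ⊎ sat e ψ
sat e (∀' φ)   = (k : ℕ) → sat (k ∷ₑ e) φ
sat e (∃' φ)   = Σ ℕ (λ k → sat (k ∷ₑ e) φ)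

noEnv : Fin 0 → ℕ
noEnv ()

ℕ⊨_ : Formula 0 → Set
ℕ⊨ φ = sat noEnv φ

infix 0 _⊢_
data _⊢_ : {n : ℕ} → List (Formula n) → Formula n → Set where
  hyp    : ∀ {n} {Γ : List (Formula n)} {φ} → φ ∈ Γ → Γ ⊢ φ
  ⊥E     : ∀ {n} {Γ : List (Formula n)} {φ} → Γ ⊢ ⊥' → Γ ⊢ φ
  raa    : ∀ {n} {Γ : List (Formula n)} {φ} → (¬' φ ∷ Γ) ⊢ ⊥' → Γ ⊢ φ
  ⇒I     : ∀ {n} {Γ : List (Formula n)} {φ ψ} → (φ ∷ Γ) ⊢ ψ → Γ ⊢ φ ⇒ ψ
  ⇒E     : ∀ {n} {Γ : List (Formula n)} {φ ψ} → Γ ⊢ φ ⇒ ψ → Γ ⊢ φ → Γ ⊢ ψ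
  ∧I     : ∀ {n} {Γ : List (Formula n)} {φ ψ} → Γ ⊢ φ → Γ ⊢ ψ → Γ ⊢ φ ∧' ψ
  ∧E₁    : ∀ {n} {Γ : List (Formula n)} {φ ψ} → Γ ⊢ φ ∧' ψ → Γ ⊢ φ
  ∧E₂    : ∀ {n} {Γ : List (Formula n)} {φ ψ} → Γ ⊢ φ ∧' ψ → Γ ⊢ ψ
  ∨I₁    : ∀ {n} {Γ : List (Formula n)} {φ ψ} → Γ ⊢ φ → Γ ⊢ φ ∨' ψ
  ∨I₂    : ∀ {n} {Γ : List (Formula n)} {φ ψ} → Γ ⊢ ψ → Γ ⊢ φ ∨' ψ
  ∨E     : ∀ {n} {Γ : List (Formula n)} {φ ψ χ} → Γ ⊢ φ ∨' ψ →
             (φ ∷ Γ) ⊢ χ → (ψ ∷ Γ) ⊢ χ → Γ ⊢ χ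
  ∀I     : ∀ {n} {Γ : List (Formula n)} {φ} → map wkF Γ ⊢ φ → Γ ⊢ ∀' φ
  ∀E     : ∀ {n} {Γ : List (Formula n)} {φ} → Γ ⊢ ∀' φ → (t : Term n) → Γ ⊢ φ [ t ]
  ∃I     : ∀ {n} {Γ : List (Formula n)} {φ} (t : Term n) → Γ ⊢ φ [ t ] → Γ ⊢ ∃' φ
  ∃E     : ∀ {n} {Γ : List (Formula n)} {φ ψ} → Γ ⊢ ∃' φ →
             (φ ∷ map wkF Γ) ⊢ wkF ψ → Γ ⊢ ψ
  ≐refl  : ∀ {n} {Γ : List (Formula n)} (t : Term n) → Γ ⊢ t ≐ t
  ≐subst : ∀ {n} {Γ : List (Formula n)} (φ : Formula (suc n)) {s t : Term n} →
             Γ ⊢ s ≐ t → Γ ⊢ φ [ s ] → Γ ⊢ φ [ t ]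

_⊢ᵀ_ : (Formula 0 → Set) → Formula 0 → Set
T ⊢ᵀ φ = Σ (List (Formula 0)) (λ Γ → All T Γ × (Γ ⊢ φ))

Inconsistent : Formula 0 → Set
Inconsistent φ = (φ ∷ []) ⊢ ⊥'

bigOr : ℕ → Formula 1
bigOr zero    = var zero ≐ num 0
bigOr (suc n) = bigOr n ∨' (var zero ≐ num (suc n))

data R₀ : Formula 0 → Set where
  ax+  : ∀ m n → R₀ (num m `+ num n ≐ num (m + n))
  ax×  : ∀ m n → R₀ (num m `× num n ≐ num (m * n))
  ax≠  : ∀ m n → m ≢ n → R₀ (¬' (num m ≐ num n))
  ax≤  : ∀ n → R₀ (∀' ((var zero ≼ num n) ⇒ bigOr n))
  ax≤' : ∀ m n → m ≤ n → R₀ (num m ≼ num n)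

wb : Formula 1
wb = (`0 ≼ var zero) ∧' ∀< (var zero) (`S (var zero) ≼ var (suc zero))

inner : Formula 1 → Formula 2
inner ψ₀ = renF (λ { zero → zero }) ψ₀

_≤ˢ_ : Formula 1 → Formula 1 → Formula 0
φ₀ ≤ˢ ψ₀ = ∃' (φ₀ ∧' ∀< (var zero) (¬' inner ψ₀))

_<ˢ_ : Formula 1 → Formula 1 → Formula 0
φ₀ <ˢ ψ₀ = ∃' (φ₀ ∧' ∀≤ (var zero) (¬' inner ψ₀))

cert : Formula 1
cert =
      (`0 ≼ v)
  ∧' ∀< v (`S (var zero) ≼ var (suc zero))
  ∧' ∀' ((var zero ≼ `0) ⇔' (var zero ≐ `0))
  ∧' ∀< v (∀' ((var zero ≼ `S (var (suc zero)))
                ⇔' ((var zero ≼ var (suc zero)) ∨' (var zero ≐ `S (var (suc zero))))))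
  -- ∀x,y,z ≤ v : S((x×y)+z) ≠ 0     (z=0, y=1, x=2, v=3)
  ∧' ∀≤ v (∀≤ (var (# 1)) (∀≤ (var (# 2))
        (¬' (`S (var (# 2) `× var (# 1) `+ var (# 0)) ≐ `0))))
  -- ∀x,y,z,w ≤ v : S((x×y)+z) = Sw → (x×y)+z = w   (w=0,z=1,y=2,x=3,v=4)
  ∧' ∀≤ v (∀≤ (var (# 1)) (∀≤ (var (# 2)) (∀≤ (var (# 3))
        ((`S (var (# 3) `× var (# 2) `+ var (# 1)) ≐ `S (var (# 0)))
          ⇒ (var (# 3) `× var (# 2) `+ var (# 1) ≐ var (# 0))))))
  -- ∀x,y ≤ v : (x×y)+0 = x×y   (y=0, x=1)
  ∧' ∀≤ v (∀≤ (var (# 1)) (var (# 1) `× var (# 0) `+ `0 ≐ var (# 1) `× var (# 0)))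
  -- ∀x,y,z ≤ v : (x×y)+Sz = S((x×y)+z)
  ∧' ∀≤ v (∀≤ (var (# 1)) (∀≤ (var (# 2))
        (var (# 2) `× var (# 1) `+ `S (var (# 0)) ≐ `S (var (# 2) `× var (# 1) `+ var (# 0)))))
  ∧' ∀≤ v (var (# 0) `× `0 ≐ `0)
  -- ∀x,y ≤ v : x×Sy = (x×y)+x
  ∧' ∀≤ v (∀≤ (var (# 1)) (var (# 1) `× `S (var (# 0)) ≐ var (# 1) `× var (# 0) `+ var (# 1)))
  where
  v : Term 1
  v = var zero

[_]ᶜ : Formula 1 → Formula 0
[ ρ₀ ]ᶜ = ∃' (cert ∧' ρ₀)

IsBullet : Formula 0 → Formula 1 → Set
IsBullet ρ ρ₀ =
  PureΔ₀ ρ₀ × (ℕ⊨ ρ → ℕ⊨ ∃' ρ₀) × (ℕ⊨ ∃' ρ₀ → ℕ⊨ ρ) × (([] ⊢ (∃' ρ₀ ⇒ ρ)))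

{-# OPTIONS --safe #-}
module Submission where

-- Since ℕ ⊨ σ ≤ σ′ (resp. σ < σ′), the sentence X := σ′ < σ (resp. σ′ ≤ σ) is false,
-- so by soundness of R₀ the sentence ρ is false and ρ₀ has no standard witness.
-- Now let cert(x) ∧ ρ₀(x). The first clauses of cert make x closed under successor
-- below itself, so for any N either x is a numeral k ≤ N or all numerals ≤ N lie below x.
-- If x = k, the recursive clauses of cert evaluate the pure formula ρ₀(k) correctly,
-- which refutes it. Otherwise cert proves the arithmetic of numerals up to N, hence
-- the finitely many R₀-axioms that give ρ ↔ X; so ρ₀(x) yields ρ and then X. The same
-- arithmetic refutes X: its witness y is well-behaved as well, so it is either a small
-- numeral, which is no witness of σ′, or lies above the σ-witness, which X excludes.

open import Defs
open import Data.Nat using (ℕ; zero; suc; _+_; _*_; _≤_; _<_; _⊔_; z≤n; s≤s; _≤?_)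
open import Data.Nat.Properties
  using (_≟_; *-identityʳ; *-suc; *-zeroʳ; +-comm; +-identityʳ; +-suc; <-irrefl; <⇒≤;
         m≤m⊔n; m≤n⊔m; m≤n⇒m<n∨m≡n; m≤n⇒m≤1+n; n≤1+n; n≤0⇒n≡0; ≤-pred; ≤-refl; ≤-reflexive;
         ≤-trans; ≤∧≢⇒<; ≰⇒>; allUpTo?; anyUpTo?)
open import Data.Fin using (Fin; zero; suc; #_)
open import Data.List using (List; []; _∷_; map)
open import Data.List.Membership.Propositional using (_∈_)
open import Data.List.Membership.Propositional.Properties using (∈-map⁺; ∈-map⁻)
open import Data.List.Relation.Binary.Subset.Propositional using (_⊆_)
open import Data.List.Relation.Binary.Subset.Propositional.Properties
  using (⊆-refl; xs⊆x∷xs; ∷⁺ʳ) renaming (map⁺ to ⊆-map⁺)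
open import Data.List.Relation.Unary.Any using (here; there)
open import Data.List.Relation.Unary.All using (All; []; _∷_)
open import Data.Product using (Σ; ∃-syntax; _×_; _,_; proj₁; proj₂)
open import Data.Sum using (_⊎_; inj₁; inj₂; swap; [_,_]′) renaming (map to ⊎-map)
open import Data.Empty using (⊥; ⊥-elim)
open import Data.Unit using (⊤; tt)
open import Function.Bundles using (_⇔_; mk⇔; Equivalence)
open import Relation.Nullary using (¬_; Dec; yes; no)
open import Relation.Nullary.Decidable using (map′; decidable-stable; _×-dec_; _⊎-dec_; _→-dec_)
open import Relation.Binary.PropositionalEquality
  using (_≡_; _≢_; refl; sym; trans; cong; cong₂; subst; subst₂)

open Equivalence using (to; from)

renT-renT : ∀ {a b c} {r₁ : Fin b → Fin c} {r₂ : Fin a → Fin b} {r : Fin a → Fin c} →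
            (∀ i → r₁ (r₂ i) ≡ r i) → ∀ t → renT r₁ (renT r₂ t) ≡ renT r t
renT-renT h (var i)  = cong var (h i)
renT-renT h `0       = refl
renT-renT h (`S t)   = cong `S (renT-renT h t)
renT-renT h (s `+ t) = cong₂ _`+_ (renT-renT h s) (renT-renT h t)
renT-renT h (s `× t) = cong₂ _`×_ (renT-renT h s) (renT-renT h t)

liftR-liftR : ∀ {a b c} {r₁ : Fin b → Fin c} {r₂ : Fin a → Fin b} {r : Fin a → Fin c} →
              (∀ i → r₁ (r₂ i) ≡ r i) → ∀ i → liftR r₁ (liftR r₂ i) ≡ liftR r i
liftR-liftR h zero    = refl
liftR-liftR h (suc i) = cong suc (h i)

renF-renF : ∀ {a b c} {r₁ : Fin b → Fin c} {r₂ : Fin a → Fin b} {r : Fin a → Fin c} →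
            (∀ i → r₁ (r₂ i) ≡ r i) → ∀ φ → renF r₁ (renF r₂ φ) ≡ renF r φ
renF-renF h ⊥'       = refl
renF-renF h (s ≐ t)  = cong₂ _≐_ (renT-renT h s) (renT-renT h t)
renF-renF h (s ≼ t)  = cong₂ _≼_ (renT-renT h s) (renT-renT h t)
renF-renF h (φ ⇒ ψ)  = cong₂ _⇒_ (renF-renF h φ) (renF-renF h ψ)
renF-renF h (φ ∧' ψ) = cong₂ _∧'_ (renF-renF h φ) (renF-renF h ψ)
renF-renF h (φ ∨' ψ) = cong₂ _∨'_ (renF-renF h φ) (renF-renF h ψ)
renF-renF h (∀' φ)   = cong ∀' (renF-renF (liftR-liftR h) φ)
renF-renF h (∃' φ)   = cong ∃' (renF-renF (liftR-liftR h) φ)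

subT-renT : ∀ {a b c} {s : Fin b → Term c} {r : Fin a → Fin b} {s' : Fin a → Term c} →
            (∀ i → s (r i) ≡ s' i) → ∀ t → subT s (renT r t) ≡ subT s' t
subT-renT h (var i)  = h i
subT-renT h `0       = refl
subT-renT h (`S t)   = cong `S (subT-renT h t)
subT-renT h (u `+ t) = cong₂ _`+_ (subT-renT h u) (subT-renT h t)
subT-renT h (u `× t) = cong₂ _`×_ (subT-renT h u) (subT-renT h t)

liftS-liftR : ∀ {a b c} {s : Fin b → Term c} {r : Fin a → Fin b} {s' : Fin a → Term c} →
              (∀ i → s (r i) ≡ s' i) → ∀ i → liftS s (liftR r i) ≡ liftS s' i
liftS-liftR h zero    = refl
liftS-liftR h (suc i) = cong wkT (h i)

subF-renF : ∀ {a b c} {s : Fin b → Term c} {r : Fin a → Fin b} {s' : Fin a → Term c} →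
            (∀ i → s (r i) ≡ s' i) → ∀ φ → subF s (renF r φ) ≡ subF s' φ
subF-renF h ⊥'       = refl
subF-renF h (u ≐ t)  = cong₂ _≐_ (subT-renT h u) (subT-renT h t)
subF-renF h (u ≼ t)  = cong₂ _≼_ (subT-renT h u) (subT-renT h t)
subF-renF h (φ ⇒ ψ)  = cong₂ _⇒_ (subF-renF h φ) (subF-renF h ψ)
subF-renF h (φ ∧' ψ) = cong₂ _∧'_ (subF-renF h φ) (subF-renF h ψ)
subF-renF h (φ ∨' ψ) = cong₂ _∨'_ (subF-renF h φ) (subF-renF h ψ)
subF-renF h (∀' φ)   = cong ∀' (subF-renF (liftS-liftR h) φ)
subF-renF h (∃' φ)   = cong ∃' (subF-renF (liftS-liftR h) φ)

renT-subT : ∀ {a b c} {r : Fin b → Fin c} {s : Fin a → Term b} {s' : Fin a → Term c} →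
            (∀ i → renT r (s i) ≡ s' i) → ∀ t → renT r (subT s t) ≡ subT s' t
renT-subT h (var i)  = h i
renT-subT h `0       = refl
renT-subT h (`S t)   = cong `S (renT-subT h t)
renT-subT h (u `+ t) = cong₂ _`+_ (renT-subT h u) (renT-subT h t)
renT-subT h (u `× t) = cong₂ _`×_ (renT-subT h u) (renT-subT h t)

wkT-renT : ∀ {a b} (r : Fin a → Fin b) t → renT (liftR r) (wkT t) ≡ wkT (renT r t)
wkT-renT r t = trans (renT-renT (λ _ → refl) t) (sym (renT-renT (λ _ → refl) t))

liftR-liftS : ∀ {a b c} {r : Fin b → Fin c} {s : Fin a → Term b} {s' : Fin a → Term c} →
              (∀ i → renT r (s i) ≡ s' i) → ∀ i → renT (liftR r) (liftS s i) ≡ liftS s' i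
liftR-liftS h zero    = refl
liftR-liftS {r = r} {s} h (suc i) = trans (wkT-renT r (s i)) (cong wkT (h i))

renF-subF : ∀ {a b c} {r : Fin b → Fin c} {s : Fin a → Term b} {s' : Fin a → Term c} →
            (∀ i → renT r (s i) ≡ s' i) → ∀ φ → renF r (subF s φ) ≡ subF s' φ
renF-subF h ⊥'       = refl
renF-subF h (u ≐ t)  = cong₂ _≐_ (renT-subT h u) (renT-subT h t)
renF-subF h (u ≼ t)  = cong₂ _≼_ (renT-subT h u) (renT-subT h t)
renF-subF h (φ ⇒ ψ)  = cong₂ _⇒_ (renF-subF h φ) (renF-subF h ψ)
renF-subF h (φ ∧' ψ) = cong₂ _∧'_ (renF-subF h φ) (renF-subF h ψ)
renF-subF h (φ ∨' ψ) = cong₂ _∨'_ (renF-subF h φ) (renF-subF h ψ)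
renF-subF h (∀' φ)   = cong ∀' (renF-subF (liftR-liftS h) φ)
renF-subF h (∃' φ)   = cong ∃' (renF-subF (liftR-liftS h) φ)

liftS-wkT : ∀ {a b} (s : Fin a → Term b) t → subT (liftS s) (wkT t) ≡ wkT (subT s t)
liftS-wkT s t = trans (subT-renT (λ _ → refl) t) (sym (renT-subT (λ _ → refl) t))

subT-subT : ∀ {a b c} {s₁ : Fin b → Term c} {s₂ : Fin a → Term b} {s : Fin a → Term c} →
            (∀ i → subT s₁ (s₂ i) ≡ s i) → ∀ t → subT s₁ (subT s₂ t) ≡ subT s t
subT-subT h (var i)  = h i
subT-subT h `0       = refl
subT-subT h (`S t)   = cong `S (subT-subT h t)
subT-subT h (u `+ t) = cong₂ _`+_ (subT-subT h u) (subT-subT h t)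
subT-subT h (u `× t) = cong₂ _`×_ (subT-subT h u) (subT-subT h t)

liftS-liftS : ∀ {a b c} {s₁ : Fin b → Term c} {s₂ : Fin a → Term b} {s : Fin a → Term c} →
              (∀ i → subT s₁ (s₂ i) ≡ s i) → ∀ i → subT (liftS s₁) (liftS s₂ i) ≡ liftS s i
liftS-liftS h zero    = refl
liftS-liftS {s₁ = s₁} {s₂} h (suc i) = trans (liftS-wkT s₁ (s₂ i)) (cong wkT (h i))

subF-subF : ∀ {a b c} {s₁ : Fin b → Term c} {s₂ : Fin a → Term b} {s : Fin a → Term c} →
            (∀ i → subT s₁ (s₂ i) ≡ s i) → ∀ φ → subF s₁ (subF s₂ φ) ≡ subF s φ
subF-subF h ⊥'       = refl
subF-subF h (u ≐ t)  = cong₂ _≐_ (subT-subT h u) (subT-subT h t)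
subF-subF h (u ≼ t)  = cong₂ _≼_ (subT-subT h u) (subT-subT h t)
subF-subF h (φ ⇒ ψ)  = cong₂ _⇒_ (subF-subF h φ) (subF-subF h ψ)
subF-subF h (φ ∧' ψ) = cong₂ _∧'_ (subF-subF h φ) (subF-subF h ψ)
subF-subF h (φ ∨' ψ) = cong₂ _∨'_ (subF-subF h φ) (subF-subF h ψ)
subF-subF h (∀' φ)   = cong ∀' (subF-subF (liftS-liftS h) φ)
subF-subF h (∃' φ)   = cong ∃' (subF-subF (liftS-liftS h) φ)

subT-id : ∀ {a} {s : Fin a → Term a} → (∀ i → s i ≡ var i) → ∀ t → subT s t ≡ t
subT-id h (var i)  = h i
subT-id h `0       = refl
subT-id h (`S t)   = cong `S (subT-id h t)
subT-id h (u `+ t) = cong₂ _`+_ (subT-id h u) (subT-id h t)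
subT-id h (u `× t) = cong₂ _`×_ (subT-id h u) (subT-id h t)

liftS-id : ∀ {a} {s : Fin a → Term a} → (∀ i → s i ≡ var i) → ∀ i → liftS s i ≡ var i
liftS-id h zero    = refl
liftS-id h (suc i) = cong wkT (h i)

subF-id : ∀ {a} {s : Fin a → Term a} → (∀ i → s i ≡ var i) → ∀ φ → subF s φ ≡ φ
subF-id h ⊥'       = refl
subF-id h (u ≐ t)  = cong₂ _≐_ (subT-id h u) (subT-id h t)
subF-id h (u ≼ t)  = cong₂ _≼_ (subT-id h u) (subT-id h t)
subF-id h (φ ⇒ ψ)  = cong₂ _⇒_ (subF-id h φ) (subF-id h ψ)
subF-id h (φ ∧' ψ) = cong₂ _∧'_ (subF-id h φ) (subF-id h ψ)
subF-id h (φ ∨' ψ) = cong₂ _∨'_ (subF-id h φ) (subF-id h ψ)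
subF-id h (∀' φ)   = cong ∀' (subF-id (liftS-id h) φ)
subF-id h (∃' φ)   = cong ∃' (subF-id (liftS-id h) φ)

sub0-wkT : ∀ {n} (u : Term n) t → subT (sub0 u) (wkT t) ≡ t
sub0-wkT u t = trans (subT-renT (λ _ → refl) t) (subT-id (λ _ → refl) t)

wkF-renF : ∀ {m n} (r : Fin m → Fin n) φ → renF (liftR r) (wkF φ) ≡ wkF (renF r φ)
wkF-renF r φ = trans (renF-renF (λ _ → refl) φ) (sym (renF-renF (λ _ → refl) φ))

renF-[] : ∀ {m n} (r : Fin m → Fin n) φ t → renF r (φ [ t ]) ≡ renF (liftR r) φ [ renT r t ]
renF-[] r φ t = trans (renF-subF {s' = λ i → sub0 (renT r t) (liftR r i)} h φ)
                      (sym (subF-renF (λ _ → refl) φ))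
  where
  h : ∀ i → renT r (sub0 t i) ≡ sub0 (renT r t) (liftR r i)
  h zero    = refl
  h (suc i) = refl

renF-as-subF : ∀ {a b} (r : Fin a → Fin b) φ → renF r φ ≡ subF (λ i → var (r i)) φ
renF-as-subF r φ = trans (sym (subF-id (λ _ → refl) (renF r φ))) (subF-renF (λ _ → refl) φ)

renT-num : ∀ {a b} (r : Fin a → Fin b) k → renT r (num k) ≡ num k
renT-num r zero    = refl
renT-num r (suc k) = cong `S (renT-num r k)

subT-num : ∀ {a b} (s : Fin a → Term b) k → subT s (num k) ≡ num k
subT-num s zero    = refl
subT-num s (suc k) = cong `S (subT-num s k)

subT-cong : ∀ {a b} {s s' : Fin a → Term b} → (∀ i → s i ≡ s' i) → ∀ t → subT s t ≡ subT s' t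
subT-cong h (var i)  = h i
subT-cong h `0       = refl
subT-cong h (`S t)   = cong `S (subT-cong h t)
subT-cong h (u `+ t) = cong₂ _`+_ (subT-cong h u) (subT-cong h t)
subT-cong h (u `× t) = cong₂ _`×_ (subT-cong h u) (subT-cong h t)

liftS-cong : ∀ {a b} {s s' : Fin a → Term b} → (∀ i → s i ≡ s' i) → ∀ i → liftS s i ≡ liftS s' i
liftS-cong h zero    = refl
liftS-cong h (suc i) = cong wkT (h i)

subF-cong : ∀ {a b} {s s' : Fin a → Term b} → (∀ i → s i ≡ s' i) → ∀ φ → subF s φ ≡ subF s' φ
subF-cong h ⊥'       = refl
subF-cong h (u ≐ t)  = cong₂ _≐_ (subT-cong h u) (subT-cong h t)
subF-cong h (u ≼ t)  = cong₂ _≼_ (subT-cong h u) (subT-cong h t)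
subF-cong h (φ ⇒ ψ)  = cong₂ _⇒_ (subF-cong h φ) (subF-cong h ψ)
subF-cong h (φ ∧' ψ) = cong₂ _∧'_ (subF-cong h φ) (subF-cong h ψ)
subF-cong h (φ ∨' ψ) = cong₂ _∨'_ (subF-cong h φ) (subF-cong h ψ)
subF-cong h (∀' φ)   = cong ∀' (subF-cong (liftS-cong h) φ)
subF-cong h (∃' φ)   = cong ∃' (subF-cong (liftS-cong h) φ)

weaken : ∀ {n} {Γ Δ : List (Formula n)} {φ} → Γ ⊆ Δ → Γ ⊢ φ → Δ ⊢ φ
weaken h (hyp p)         = hyp (h p)
weaken h (⊥E d)          = ⊥E (weaken h d)
weaken h (raa d)         = raa (weaken (∷⁺ʳ _ h) d)
weaken h (⇒I d)          = ⇒I (weaken (∷⁺ʳ _ h) d)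
weaken h (⇒E d e)        = ⇒E (weaken h d) (weaken h e)
weaken h (∧I d e)        = ∧I (weaken h d) (weaken h e)
weaken h (∧E₁ d)         = ∧E₁ (weaken h d)
weaken h (∧E₂ d)         = ∧E₂ (weaken h d)
weaken h (∨I₁ d)         = ∨I₁ (weaken h d)
weaken h (∨I₂ d)         = ∨I₂ (weaken h d)
weaken h (∨E d e f)      = ∨E (weaken h d) (weaken (∷⁺ʳ _ h) e) (weaken (∷⁺ʳ _ h) f)
weaken h (∀I d)          = ∀I (weaken (⊆-map⁺ wkF h) d)
weaken h (∀E d t)        = ∀E (weaken h d) t
weaken h (∃I t d)        = ∃I t (weaken h d)
weaken h (∃E d e)        = ∃E (weaken h d) (weaken (∷⁺ʳ _ (⊆-map⁺ wkF h)) e)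
weaken h (≐refl t)       = ≐refl t
weaken h (≐subst φ d e)  = ≐subst φ (weaken h d) (weaken h e)

weaken₁ : ∀ {n} {Γ : List (Formula n)} {φ ψ} → Γ ⊢ φ → (ψ ∷ Γ) ⊢ φ
weaken₁ = weaken (xs⊆x∷xs _ _)

⊆-there : ∀ {n} {Γ Δ : List (Formula n)} {φ} → Γ ⊆ Δ → Γ ⊆ (φ ∷ Δ)
⊆-there h p = there (h p)

retype : ∀ {n} {Γ : List (Formula n)} {φ ψ} → φ ≡ ψ → Γ ⊢ φ → Γ ⊢ ψ
retype refl d = d

map-wkF-renF : ∀ {m n} (r : Fin m → Fin n) Γ →
               map (renF (liftR r)) (map wkF Γ) ≡ map wkF (map (renF r) Γ)
map-wkF-renF r []      = refl
map-wkF-renF r (ψ ∷ Γ) = cong₂ _∷_ (wkF-renF r ψ) (map-wkF-renF r Γ)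

rename : ∀ {m n} (r : Fin m → Fin n) {Γ φ} → Γ ⊢ φ → map (renF r) Γ ⊢ renF r φ
rename r (hyp p)     = hyp (∈-map⁺ (renF r) p)
rename r (⊥E d)      = ⊥E (rename r d)
rename r (raa d)     = raa (rename r d)
rename r (⇒I d)      = ⇒I (rename r d)
rename r (⇒E d e)    = ⇒E (rename r d) (rename r e)
rename r (∧I d e)    = ∧I (rename r d) (rename r e)
rename r (∧E₁ d)     = ∧E₁ (rename r d)
rename r (∧E₂ d)     = ∧E₂ (rename r d)
rename r (∨I₁ d)     = ∨I₁ (rename r d)
rename r (∨I₂ d)     = ∨I₂ (rename r d)
rename r (∨E d e f)  = ∨E (rename r d) (rename r e) (rename r f)
rename r {Γ} (∀I d)  = ∀I (subst (_⊢ _) (map-wkF-renF r Γ) (rename (liftR r) d))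
rename r (∀E {φ = φ} d t) = retype (sym (renF-[] r φ t)) (∀E (rename r d) (renT r t))
rename r (∃I {φ = φ} t d) = ∃I (renT r t) (retype (renF-[] r φ t) (rename r d))
rename r {Γ} (∃E {φ = φ} {ψ} d e) =
  ∃E (rename r d) (subst₂ (λ Δ χ → (renF (liftR r) φ ∷ Δ) ⊢ χ)
                          (map-wkF-renF r Γ) (wkF-renF r ψ) (rename (liftR r) e))
rename r (≐refl t) = ≐refl (renT r t)
rename r (≐subst φ {s} {t} d e) =
  retype (sym (renF-[] r φ t))
    (≐subst (renF (liftR r) φ) (rename r d) (retype (renF-[] r φ s) (rename r e)))

weakenVar : ∀ {n} {Γ : List (Formula n)} {φ} → Γ ⊢ φ → map wkF Γ ⊢ wkF φ
weakenVar = rename suc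

cut : ∀ {n} (Γ : List (Formula n)) {Δ φ} → (∀ {ψ} → ψ ∈ Γ → Δ ⊢ ψ) → Γ ⊢ φ → Δ ⊢ φ
cut []      h d = weaken (λ ()) d
cut (ψ ∷ Γ) h d = ⇒E (cut Γ (λ p → h (there p)) (⇒I d)) (h (here refl))

by-cases : ∀ {n} {Γ : List (Formula n)} φ {χ} → (φ ∷ Γ) ⊢ χ → (¬' φ ∷ Γ) ⊢ χ → Γ ⊢ χ
by-cases φ d₁ d₂ =
  raa (⇒E (hyp (here refl)) (⇒E (⇒I (weaken swap₁ d₂))
                                  (⇒I (⇒E (hyp (there (here refl))) (weaken swap₁ d₁)))))
  where
  swap₁ : ∀ {A B Γ} → (A ∷ Γ) ⊆ (A ∷ B ∷ Γ)
  swap₁ (here p)  = here p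
  swap₁ (there q) = there (there q)

transport : ∀ {n} {Γ : List (Formula n)} (χ : Formula (suc n)) {s t φ ψ} →
            Γ ⊢ s ≐ t → Γ ⊢ φ → χ [ s ] ≡ φ → χ [ t ] ≡ ψ → Γ ⊢ ψ
transport χ eq d p q = retype q (≐subst χ eq (retype (sym p) d))

≐-sym : ∀ {n} {Γ : List (Formula n)} {s t} → Γ ⊢ s ≐ t → Γ ⊢ t ≐ s
≐-sym {s = s} {t} eq =
  transport (var zero ≐ wkT s) eq (≐refl s) (cong (s ≐_) (sub0-wkT s s)) (cong (t ≐_) (sub0-wkT t s))

≐-trans : ∀ {n} {Γ : List (Formula n)} {s t u} → Γ ⊢ s ≐ t → Γ ⊢ t ≐ u → Γ ⊢ s ≐ u
≐-trans {s = s} {t} {u} p q =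
  transport (wkT s ≐ var zero) q p (cong (_≐ t) (sub0-wkT t s)) (cong (_≐ u) (sub0-wkT u s))

≼-respʳ-≐ : ∀ {n} {Γ : List (Formula n)} {u a b} → Γ ⊢ u ≼ a → Γ ⊢ a ≐ b → Γ ⊢ u ≼ b
≼-respʳ-≐ {u = u} {a} {b} d eq =
  transport (wkT u ≼ var zero) eq d (cong (_≼ a) (sub0-wkT a u)) (cong (_≼ b) (sub0-wkT b u))

≼-respˡ-≐ : ∀ {n} {Γ : List (Formula n)} {u a b} → Γ ⊢ a ≼ u → Γ ⊢ a ≐ b → Γ ⊢ b ≼ u
≼-respˡ-≐ {u = u} {a} {b} d eq =
  transport (var zero ≼ wkT u) eq d (cong (a ≼_) (sub0-wkT a u)) (cong (b ≼_) (sub0-wkT b u))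

≐-cong : ∀ {n} {Γ : List (Formula n)} (T : Term (suc n)) {s t} → Γ ⊢ s ≐ t →
         Γ ⊢ subT (sub0 s) T ≐ subT (sub0 t) T
≐-cong T {s} {t} eq = transport (wkT (subT (sub0 s) T) ≐ T) eq (≐refl _)
  (cong (_≐ subT (sub0 s) T) (sub0-wkT s _)) (cong (_≐ subT (sub0 t) T) (sub0-wkT t _))

≐-congS : ∀ {n} {Γ : List (Formula n)} {s s'} → Γ ⊢ s ≐ s' → Γ ⊢ `S s ≐ `S s'
≐-congS = ≐-cong (`S (var zero))

≐-cong+ : ∀ {n} {Γ : List (Formula n)} {s s' t t'} →
          Γ ⊢ s ≐ s' → Γ ⊢ t ≐ t' → Γ ⊢ s `+ t ≐ s' `+ t'
≐-cong+ {s = s} {s'} {t} {t'} e₁ e₂ = ≐-trans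
  (retype (cong₂ (λ a b → s `+ a ≐ s' `+ b) (sub0-wkT s t) (sub0-wkT s' t))
          (≐-cong (var zero `+ wkT t) e₁))
  (retype (cong₂ (λ a b → a `+ t ≐ b `+ t') (sub0-wkT t s') (sub0-wkT t' s'))
          (≐-cong (wkT s' `+ var zero) e₂))

≐-cong× : ∀ {n} {Γ : List (Formula n)} {s s' t t'} →
          Γ ⊢ s ≐ s' → Γ ⊢ t ≐ t' → Γ ⊢ s `× t ≐ s' `× t'
≐-cong× {s = s} {s'} {t} {t'} e₁ e₂ = ≐-trans
  (retype (cong₂ (λ a b → s `× a ≐ s' `× b) (sub0-wkT s t) (sub0-wkT s' t))
          (≐-cong (var zero `× wkT t) e₁))
  (retype (cong₂ (λ a b → a `× t ≐ b `× t') (sub0-wkT t s') (sub0-wkT t' s'))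
          (≐-cong (wkT s' `× var zero) e₂))

⌜_⌝ : ∀ {n m} → (Fin n → ℕ) → Fin n → Term m
⌜ e ⌝ i = num (e i)

renF-⌜⌝ : ∀ {n m l} (r : Fin m → Fin l) (e : Fin n → ℕ) φ → renF r (subF ⌜ e ⌝ φ) ≡ subF ⌜ e ⌝ φ
renF-⌜⌝ r e φ = renF-subF (λ j → renT-num r (e j)) φ

infixr 5 _∷ₛ_
_∷ₛ_ : ∀ {n m} → Term m → (Fin n → Term m) → Fin (suc n) → Term m
(u ∷ₛ σ) zero    = u
(u ∷ₛ σ) (suc i) = σ i

liftS-[] : ∀ {a b} (σ : Fin a → Term b) φ u → subF (liftS σ) φ [ u ] ≡ subF (u ∷ₛ σ) φ
liftS-[] σ φ u = subF-subF h φ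
  where
  h : ∀ i → subT (sub0 u) (liftS σ i) ≡ (u ∷ₛ σ) i
  h zero    = refl
  h (suc i) = sub0-wkT u (σ i)

liftS-⌜⌝-[] : ∀ {n m} (e : Fin n → ℕ) φ k → subF (liftS (⌜_⌝ {m = m} e)) φ [ num k ] ≡ subF ⌜ k ∷ₑ e ⌝ φ
liftS-⌜⌝-[] e φ k = trans (liftS-[] ⌜ e ⌝ φ (num k)) (subF-cong h φ)
  where
  h : ∀ i → (num k ∷ₛ ⌜ e ⌝) i ≡ ⌜ k ∷ₑ e ⌝ i
  h zero    = refl
  h (suc i) = refl

liftS-bound : ∀ {a b} (σ : Fin a → Term b) t u → subT (sub0 u) (subT (liftS σ) (wkT t)) ≡ subT σ t
liftS-bound σ t u = trans (cong (subT (sub0 u)) (liftS-wkT σ t)) (sub0-wkT u (subT σ t))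

subF-var : ∀ {n} {Γ : List (Formula n)} φ → Γ ⊢ φ → Γ ⊢ subF var φ
subF-var φ = retype (sym (subF-id (λ _ → refl) φ))

inst-∀ : ∀ {a b} {Γ : List (Formula b)} (σ : Fin a → Term b) φ →
         Γ ⊢ subF σ (∀' φ) → ∀ u → Γ ⊢ subF (u ∷ₛ σ) φ
inst-∀ σ φ d u = retype (liftS-[] σ φ u) (∀E d u)

inst-∀≤ : ∀ {a b} {Γ : List (Formula b)} (σ : Fin a → Term b) t φ {u} →
          Γ ⊢ subF σ (∀≤ t φ) → Γ ⊢ u ≼ subT σ t → Γ ⊢ subF (u ∷ₛ σ) φ
inst-∀≤ σ t φ {u} d h =
  ⇒E (retype (cong₂ _⇒_ (cong (u ≼_) (liftS-bound σ t u)) (liftS-[] σ φ u)) (∀E d u)) h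

inst-∀< : ∀ {a b} {Γ : List (Formula b)} (σ : Fin a → Term b) t φ {u} →
          Γ ⊢ subF σ (∀< t φ) → Γ ⊢ u ≼ subT σ t → Γ ⊢ ¬' (u ≐ subT σ t) → Γ ⊢ subF (u ∷ₛ σ) φ
inst-∀< σ t φ {u} d h₁ h₂ =
  ⇒E (retype (cong₂ _⇒_ (cong₂ _∧'_ (cong (u ≼_) (liftS-bound σ t u))
                                      (cong (λ b → ¬' (u ≐ b)) (liftS-bound σ t u)))
                         (liftS-[] σ φ u))
             (∀E d u))
     (∧I h₁ h₂)

_⟨_⟩ : ∀ {m} → Formula 1 → Term m → Formula m
W ⟨ u ⟩ = subF (λ { zero → u }) W

⌜⌝-⟨⟩ : ∀ {m} (W : Formula 1) k → subF (⌜_⌝ {m = m} (k ∷ₑ noEnv)) W ≡ W ⟨ num k ⟩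
⌜⌝-⟨⟩ W k = subF-cong (λ { zero → refl }) W

⟨⟩-transport : ∀ {m} {Γ : List (Formula m)} (W : Formula 1) {u u'} →
               Γ ⊢ u ≐ u' → Γ ⊢ W ⟨ u ⟩ → Γ ⊢ W ⟨ u' ⟩
⟨⟩-transport W eq d =
  transport (W ⟨ var zero ⟩) eq d (subF-subF (λ { zero → refl }) W) (subF-subF (λ { zero → refl }) W)

isNum≤ : ∀ {m} → Term m → ℕ → Formula m
isNum≤ t zero    = t ≐ num 0
isNum≤ t (suc n) = isNum≤ t n ∨' (t ≐ num (suc n))

bigOr-isNum≤ : ∀ k → bigOr k ≡ isNum≤ (var zero) k
bigOr-isNum≤ zero    = refl
bigOr-isNum≤ (suc k) = cong (_∨' (var zero ≐ num (suc k))) (bigOr-isNum≤ k)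

subF-isNum≤ : ∀ {a b} (s : Fin a → Term b) t k → subF s (isNum≤ t k) ≡ isNum≤ (subT s t) k
subF-isNum≤ s t zero    = refl
subF-isNum≤ s t (suc k) = cong₂ _∨'_ (subF-isNum≤ s t k) (cong (subT s t ≐_) (cong `S (subT-num s k)))

renF-isNum≤ : ∀ {a b} (r : Fin a → Fin b) t k → renF r (isNum≤ t k) ≡ isNum≤ (renT r t) k
renF-isNum≤ r t zero    = refl
renF-isNum≤ r t (suc k) = cong₂ _∨'_ (renF-isNum≤ r t k) (cong (renT r t ≐_) (cong `S (renT-num r k)))

isNum≤-elim : ∀ {n} {Γ : List (Formula n)} {u χ} k → Γ ⊢ isNum≤ u k →
              (∀ i → i ≤ k → Γ ⊢ (u ≐ num i) ⇒ χ) → Γ ⊢ χ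
isNum≤-elim zero    d h = ⇒E (h 0 z≤n) d
isNum≤-elim (suc k) d h =
  ∨E d (isNum≤-elim k (hyp (here refl)) (λ i p → weaken₁ (h i (m≤n⇒m≤1+n p))))
       (⇒E (weaken₁ (h (suc k) ≤-refl)) (hyp (here refl)))

leAxiom : ∀ {m} → ℕ → Formula m
leAxiom k = ∀' ((var zero ≼ num k) ⇒ isNum≤ (var zero) k)

renF-leAxiom : ∀ {a b} (r : Fin a → Fin b) k → renF r (leAxiom k) ≡ leAxiom k
renF-leAxiom r k =
  cong ∀' (cong₂ _⇒_ (cong (var zero ≼_) (renT-num _ k)) (renF-isNum≤ _ (var zero) k))

leAxiom-elim : ∀ {n} {Γ : List (Formula n)} {k u} → Γ ⊢ leAxiom k → Γ ⊢ u ≼ num k → Γ ⊢ isNum≤ u k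
leAxiom-elim {k = k} {u} d le =
  ⇒E (retype (cong₂ _⇒_ (cong (u ≼_) (subT-num _ k)) (subF-isNum≤ _ (var zero) k)) (∀E d u)) le

evalT-renT : ∀ {a b} {e : Fin b → ℕ} {r : Fin a → Fin b} {e' : Fin a → ℕ} →
             (∀ i → e (r i) ≡ e' i) → ∀ t → evalT e (renT r t) ≡ evalT e' t
evalT-renT h (var i)  = h i
evalT-renT h `0       = refl
evalT-renT h (`S t)   = cong suc (evalT-renT h t)
evalT-renT h (s `+ t) = cong₂ _+_ (evalT-renT h s) (evalT-renT h t)
evalT-renT h (s `× t) = cong₂ _*_ (evalT-renT h s) (evalT-renT h t)

evalT-wkT : ∀ {n} k (e : Fin n → ℕ) t → evalT (k ∷ₑ e) (wkT t) ≡ evalT e t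
evalT-wkT k e = evalT-renT (λ _ → refl)

evalT-subT : ∀ {a b} {e : Fin b → ℕ} {s : Fin a → Term b} {e' : Fin a → ℕ} →
             (∀ i → evalT e (s i) ≡ e' i) → ∀ t → evalT e (subT s t) ≡ evalT e' t
evalT-subT h (var i)  = h i
evalT-subT h `0       = refl
evalT-subT h (`S t)   = cong suc (evalT-subT h t)
evalT-subT h (u `+ t) = cong₂ _+_ (evalT-subT h u) (evalT-subT h t)
evalT-subT h (u `× t) = cong₂ _*_ (evalT-subT h u) (evalT-subT h t)

evalT-num : ∀ {n} (e : Fin n → ℕ) k → evalT e (num k) ≡ k
evalT-num e zero    = refl
evalT-num e (suc k) = cong suc (evalT-num e k)

sat-renF : ∀ {a b} {e : Fin b → ℕ} {r : Fin a → Fin b} {e' : Fin a → ℕ} →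
           (∀ i → e (r i) ≡ e' i) → ∀ φ → sat e (renF r φ) ⇔ sat e' φ
sat-renF h ⊥'       = mk⇔ (λ x → x) (λ x → x)
sat-renF h (s ≐ t)  = mk⇔ (λ x → trans (sym (evalT-renT h s)) (trans x (evalT-renT h t)))
                          (λ x → trans (evalT-renT h s) (trans x (sym (evalT-renT h t))))
sat-renF h (s ≼ t)  = mk⇔ (subst₂ _≤_ (evalT-renT h s) (evalT-renT h t))
                          (subst₂ _≤_ (sym (evalT-renT h s)) (sym (evalT-renT h t)))
sat-renF h (φ ⇒ ψ)  = mk⇔ (λ f x → to (sat-renF h ψ) (f (from (sat-renF h φ) x)))
                          (λ f x → from (sat-renF h ψ) (f (to (sat-renF h φ) x)))
sat-renF h (φ ∧' ψ) = mk⇔ (λ (x , y) → to (sat-renF h φ) x , to (sat-renF h ψ) y)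
                          (λ (x , y) → from (sat-renF h φ) x , from (sat-renF h ψ) y)
sat-renF h (φ ∨' ψ) = mk⇔ (⊎-map (to (sat-renF h φ)) (to (sat-renF h ψ)))
                          (⊎-map (from (sat-renF h φ)) (from (sat-renF h ψ)))
sat-renF {e = e} {r} {e'} h (∀' φ) = mk⇔ (λ f k → to (sat-renF (lift k) φ) (f k))
                                         (λ f k → from (sat-renF (lift k) φ) (f k))
  where
  lift : ∀ k i → (k ∷ₑ e) (liftR r i) ≡ (k ∷ₑ e') i
  lift k zero    = refl
  lift k (suc i) = h i
sat-renF {e = e} {r} {e'} h (∃' φ) = mk⇔ (λ (k , x) → k , to (sat-renF (lift k) φ) x)
                                         (λ (k , x) → k , from (sat-renF (lift k) φ) x)
  where
  lift : ∀ k i → (k ∷ₑ e) (liftR r i) ≡ (k ∷ₑ e') i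
  lift k zero    = refl
  lift k (suc i) = h i

sat-inner : ∀ (φ : Formula 1) k l → sat (k ∷ₑ (l ∷ₑ noEnv)) (inner φ) ⇔ sat (k ∷ₑ noEnv) φ
sat-inner φ k l = sat-renF (λ { zero → refl }) φ

sat-≼-bound : ∀ {n} k (e : Fin n → ℕ) t → sat (k ∷ₑ e) (var zero ≼ wkT t) ⇔ k ≤ evalT e t
sat-≼-bound k e t = mk⇔ (subst (k ≤_) (evalT-wkT k e t)) (subst (k ≤_) (sym (evalT-wkT k e t)))

sat-≺-bound : ∀ {n} k (e : Fin n → ℕ) t → sat (k ∷ₑ e) (var zero ≺ wkT t) ⇔ k < evalT e t
sat-≺-bound k e t =
  mk⇔ (λ (k≤ , k≢) → ≤∧≢⇒< (to (sat-≼-bound k e t) k≤) (λ eq → k≢ (trans eq (sym (evalT-wkT k e t)))))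
      (λ k< → from (sat-≼-bound k e t) (<⇒≤ k<) , λ eq → <-irrefl (trans eq (evalT-wkT k e t)) k<)

sat? : ∀ {n} {φ : Formula n} → Bounded φ → ∀ e → Dec (sat e φ)
sat? b⊥       e = no (λ x → x)
sat? (b≐ s t) e = evalT e s ≟ evalT e t
sat? (b≼ s t) e = evalT e s ≤? evalT e t
sat? (b⇒ b c) e = sat? b e →-dec sat? c e
sat? (b∧ b c) e = sat? b e ×-dec sat? c e
sat? (b∨ b c) e = sat? b e ⊎-dec sat? c e
sat? (b∀≤ t b) e = map′ (λ f k k≤ → f (s≤s (to (sat-≼-bound k e t) k≤)))
                        (λ f {k} k< → f k (from (sat-≼-bound k e t) (≤-pred k<)))
                        (allUpTo? (λ k → sat? b (k ∷ₑ e)) (suc (evalT e t)))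
sat? (b∃≤ t b) e = map′ (λ (k , k< , x) → k , from (sat-≼-bound k e t) (≤-pred k<) , x)
                        (λ (k , k≤ , x) → k , s≤s (to (sat-≼-bound k e t) k≤) , x)
                        (anyUpTo? (λ k → sat? b (k ∷ₑ e)) (suc (evalT e t)))
sat? (b∀< t b) e = map′ (λ f k k< → f (to (sat-≺-bound k e t) k<))
                        (λ f {k} k< → f k (from (sat-≺-bound k e t) k<))
                        (allUpTo? (λ k → sat? b (k ∷ₑ e)) (evalT e t))
sat? (b∃< t b) e = map′ (λ (k , k< , x) → k , from (sat-≺-bound k e t) k< , x)
                        (λ (k , k< , x) → k , to (sat-≺-bound k e t) k< , x)
                        (anyUpTo? (λ k → sat? b (k ∷ₑ e)) (evalT e t))

-- Soundness

-- The double-negation reading of ∨ and ∃ makes every formula ¬¬-stable,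
-- so that raa, ∨E and ∃E are sound constructively.
satᶜ : ∀ {n} → (Fin n → ℕ) → Formula n → Set
satᶜ e ⊥'       = ⊥
satᶜ e (s ≐ t)  = evalT e s ≡ evalT e t
satᶜ e (s ≼ t)  = evalT e s ≤ evalT e t
satᶜ e (φ ⇒ ψ)  = satᶜ e φ → satᶜ e ψ
satᶜ e (φ ∧' ψ) = satᶜ e φ × satᶜ e ψ
satᶜ e (φ ∨' ψ) = ¬ ¬ (satᶜ e φ ⊎ satᶜ e ψ)
satᶜ e (∀' φ)   = (k : ℕ) → satᶜ (k ∷ₑ e) φ
satᶜ e (∃' φ)   = ¬ ¬ (Σ ℕ λ k → satᶜ (k ∷ₑ e) φ)

satᶜ-stable : ∀ {n} φ (e : Fin n → ℕ) → ¬ ¬ satᶜ e φ → satᶜ e φ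
satᶜ-stable ⊥'       e nn = nn (λ x → x)
satᶜ-stable (s ≐ t)  e nn = decidable-stable (evalT e s ≟ evalT e t) nn
satᶜ-stable (s ≼ t)  e nn = decidable-stable (evalT e s ≤? evalT e t) nn
satᶜ-stable (φ ⇒ ψ)  e nn = λ x → satᶜ-stable ψ e (λ c → nn (λ f → c (f x)))
satᶜ-stable (φ ∧' ψ) e nn = satᶜ-stable φ e (λ c → nn (λ x → c (proj₁ x))) ,
                            satᶜ-stable ψ e (λ c → nn (λ x → c (proj₂ x)))
satᶜ-stable (φ ∨' ψ) e nn = λ c → nn (λ f → f c)
satᶜ-stable (∀' φ)   e nn = λ k → satᶜ-stable φ (k ∷ₑ e) (λ c → nn (λ f → c (f k)))
satᶜ-stable (∃' φ)   e nn = λ c → nn (λ f → f c)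

satᶜ-subF : ∀ {a b} {e : Fin b → ℕ} {s : Fin a → Term b} {e' : Fin a → ℕ} →
            (∀ i → evalT e (s i) ≡ e' i) → ∀ φ → satᶜ e (subF s φ) ⇔ satᶜ e' φ
satᶜ-subF h ⊥'       = mk⇔ (λ x → x) (λ x → x)
satᶜ-subF h (u ≐ t)  = mk⇔ (λ x → trans (sym (evalT-subT h u)) (trans x (evalT-subT h t)))
                           (λ x → trans (evalT-subT h u) (trans x (sym (evalT-subT h t))))
satᶜ-subF h (u ≼ t)  = mk⇔ (subst₂ _≤_ (evalT-subT h u) (evalT-subT h t))
                           (subst₂ _≤_ (sym (evalT-subT h u)) (sym (evalT-subT h t)))
satᶜ-subF h (φ ⇒ ψ)  = mk⇔ (λ f x → to (satᶜ-subF h ψ) (f (from (satᶜ-subF h φ) x)))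
                           (λ f x → from (satᶜ-subF h ψ) (f (to (satᶜ-subF h φ) x)))
satᶜ-subF h (φ ∧' ψ) = mk⇔ (λ (x , y) → to (satᶜ-subF h φ) x , to (satᶜ-subF h ψ) y)
                           (λ (x , y) → from (satᶜ-subF h φ) x , from (satᶜ-subF h ψ) y)
satᶜ-subF h (φ ∨' ψ) =
  mk⇔ (λ nn c → nn (λ x → c (⊎-map (to (satᶜ-subF h φ)) (to (satᶜ-subF h ψ)) x)))
      (λ nn c → nn (λ x → c (⊎-map (from (satᶜ-subF h φ)) (from (satᶜ-subF h ψ)) x)))
satᶜ-subF {e = e} {s} {e'} h (∀' φ) = mk⇔ (λ f k → to (satᶜ-subF (lift k) φ) (f k))
                                          (λ f k → from (satᶜ-subF (lift k) φ) (f k))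
  where
  lift : ∀ k i → evalT (k ∷ₑ e) (liftS s i) ≡ (k ∷ₑ e') i
  lift k zero    = refl
  lift k (suc i) = trans (evalT-wkT k e (s i)) (h i)
satᶜ-subF {e = e} {s} {e'} h (∃' φ) =
  mk⇔ (λ nn c → nn (λ (k , x) → c (k , to (satᶜ-subF (lift k) φ) x)))
      (λ nn c → nn (λ (k , x) → c (k , from (satᶜ-subF (lift k) φ) x)))
  where
  lift : ∀ k i → evalT (k ∷ₑ e) (liftS s i) ≡ (k ∷ₑ e') i
  lift k zero    = refl
  lift k (suc i) = trans (evalT-wkT k e (s i)) (h i)

satᶜ-wkF : ∀ {n} (e : Fin n → ℕ) k φ → satᶜ (k ∷ₑ e) (wkF φ) ⇔ satᶜ e φ
satᶜ-wkF e k φ = subst (λ ψ → satᶜ (k ∷ₑ e) ψ ⇔ satᶜ e φ) (sym (renF-as-subF suc φ))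
                       (satᶜ-subF (λ _ → refl) φ)

satᶜ-[] : ∀ {n} (e : Fin n → ℕ) φ t → satᶜ e (φ [ t ]) ⇔ satᶜ (evalT e t ∷ₑ e) φ
satᶜ-[] e φ t = satᶜ-subF h φ
  where
  h : ∀ i → evalT e (sub0 t i) ≡ (evalT e t ∷ₑ e) i
  h zero    = refl
  h (suc i) = refl

Models : ∀ {n} → (Fin n → ℕ) → List (Formula n) → Set
Models e Γ = ∀ {ψ} → ψ ∈ Γ → satᶜ e ψ

Models-∷ : ∀ {n} {e : Fin n → ℕ} {Γ φ} → satᶜ e φ → Models e Γ → Models e (φ ∷ Γ)
Models-∷ x h (here refl) = x
Models-∷ x h (there p)   = h p

Models-wkF : ∀ {n} {e : Fin n → ℕ} {Γ} k → Models e Γ → Models (k ∷ₑ e) (map wkF Γ)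
Models-wkF {e = e} k h p with ∈-map⁻ wkF p
... | ψ , q , refl = from (satᶜ-wkF e k ψ) (h q)

soundness : ∀ {n} {Γ : List (Formula n)} {φ} → Γ ⊢ φ → ∀ e → Models e Γ → satᶜ e φ
soundness (hyp p)    e h = h p
soundness (⊥E d)     e h = ⊥-elim (soundness d e h)
soundness {φ = φ} (raa d) e h = satᶜ-stable φ e (λ ¬x → soundness d e (Models-∷ ¬x h))
soundness (⇒I d)     e h = λ x → soundness d e (Models-∷ x h)
soundness (⇒E d d′)  e h = soundness d e h (soundness d′ e h)
soundness (∧I d d′)  e h = soundness d e h , soundness d′ e h
soundness (∧E₁ d)    e h = proj₁ (soundness d e h)
soundness (∧E₂ d)    e h = proj₂ (soundness d e h)
soundness (∨I₁ d)    e h = λ c → c (inj₁ (soundness d e h))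
soundness (∨I₂ d)    e h = λ c → c (inj₂ (soundness d e h))
soundness {φ = χ} (∨E d d₁ d₂) e h = satᶜ-stable χ e (λ c → soundness d e h
  (λ { (inj₁ x) → c (soundness d₁ e (Models-∷ x h))
     ; (inj₂ y) → c (soundness d₂ e (Models-∷ y h)) }))
soundness (∀I d)     e h = λ k → soundness d (k ∷ₑ e) (Models-wkF k h)
soundness (∀E {φ = φ} d t) e h = from (satᶜ-[] e φ t) (soundness d e h (evalT e t))
soundness (∃I {φ = φ} t d) e h = λ c → c (evalT e t , to (satᶜ-[] e φ t) (soundness d e h))
soundness (∃E {ψ = ψ} d d′) e h = satᶜ-stable ψ e (λ c → soundness d e h
  (λ (k , x) → c (to (satᶜ-wkF e k ψ) (soundness d′ (k ∷ₑ e) (Models-∷ x (Models-wkF k h))))))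
soundness (≐refl t)  e h = refl
soundness (≐subst φ {s} {t} d d′) e h =
  from (satᶜ-[] e φ t)
    (subst (λ k → satᶜ (k ∷ₑ e) φ) (soundness d e h) (to (satᶜ-[] e φ s) (soundness d′ e h)))

sat⇔satᶜ : ∀ {n} {φ : Formula n} → Bounded φ → ∀ e → sat e φ ⇔ satᶜ e φ
sat⇔satᶜ b⊥       e = mk⇔ (λ x → x) (λ x → x)
sat⇔satᶜ (b≐ s t) e = mk⇔ (λ x → x) (λ x → x)
sat⇔satᶜ (b≼ s t) e = mk⇔ (λ x → x) (λ x → x)
sat⇔satᶜ (b⇒ b c) e = mk⇔ (λ f x → to (sat⇔satᶜ c e) (f (from (sat⇔satᶜ b e) x)))
                          (λ f x → from (sat⇔satᶜ c e) (f (to (sat⇔satᶜ b e) x)))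
sat⇔satᶜ (b∧ b c) e = mk⇔ (λ (x , y) → to (sat⇔satᶜ b e) x , to (sat⇔satᶜ c e) y)
                          (λ (x , y) → from (sat⇔satᶜ b e) x , from (sat⇔satᶜ c e) y)
sat⇔satᶜ (b∨ b c) e =
  mk⇔ (λ x c′ → c′ (⊎-map (to (sat⇔satᶜ b e)) (to (sat⇔satᶜ c e)) x))
      (λ nn → decidable-stable (sat? (b∨ b c) e)
                (λ c′ → nn (λ x → c′ (⊎-map (from (sat⇔satᶜ b e)) (from (sat⇔satᶜ c e)) x))))
sat⇔satᶜ (b∀≤ t b) e = mk⇔ (λ f k k≤ → to (sat⇔satᶜ b (k ∷ₑ e)) (f k k≤))
                           (λ f k k≤ → from (sat⇔satᶜ b (k ∷ₑ e)) (f k k≤))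
sat⇔satᶜ (b∀< t b) e = mk⇔ (λ f k k< → to (sat⇔satᶜ b (k ∷ₑ e)) (f k k<))
                           (λ f k k< → from (sat⇔satᶜ b (k ∷ₑ e)) (f k k<))
sat⇔satᶜ (b∃≤ t b) e =
  mk⇔ (λ (k , k≤ , x) c → c (k , k≤ , to (sat⇔satᶜ b (k ∷ₑ e)) x))
      (λ nn → decidable-stable (sat? (b∃≤ t b) e)
                (λ c → nn (λ (k , k≤ , x) → c (k , k≤ , from (sat⇔satᶜ b (k ∷ₑ e)) x))))
sat⇔satᶜ (b∃< t b) e =
  mk⇔ (λ (k , k< , x) c → c (k , k< , to (sat⇔satᶜ b (k ∷ₑ e)) x))
      (λ nn → decidable-stable (sat? (b∃< t b) e)
                (λ c → nn (λ (k , k< , x) → c (k , k< , from (sat⇔satᶜ b (k ∷ₑ e)) x))))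

Σ₁-sat⇒satᶜ : ∀ {n} {φ : Formula n} → IsΣ₁ φ → ∀ e → sat e φ → satᶜ e φ
Σ₁-sat⇒satᶜ (σbnd b) e x       = to (sat⇔satᶜ b e) x
Σ₁-sat⇒satᶜ (σ∃ p)   e (k , x) = λ c → c (k , Σ₁-sat⇒satᶜ p (k ∷ₑ e) x)

Σ₁-satᶜ⇒¬¬sat : ∀ {n} {φ : Formula n} → IsΣ₁ φ → ∀ e → satᶜ e φ → ¬ ¬ sat e φ
Σ₁-satᶜ⇒¬¬sat (σbnd b) e x c = c (from (sat⇔satᶜ b e) x)
Σ₁-satᶜ⇒¬¬sat (σ∃ p)   e nn c = nn (λ (k , x) → Σ₁-satᶜ⇒¬¬sat p (k ∷ₑ e) x (λ y → c (k , y)))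

isNum≤-complete : ∀ k n → k ≤ n → satᶜ (k ∷ₑ noEnv) (isNum≤ (var zero) n)
isNum≤-complete k zero    k≤0 = n≤0⇒n≡0 k≤0
isNum≤-complete k (suc n) k≤n with m≤n⇒m<n∨m≡n k≤n
... | inj₁ k<1+n = λ c → c (inj₁ (isNum≤-complete k n (≤-pred k<1+n)))
... | inj₂ k≡1+n = λ c → c (inj₂ (trans k≡1+n (sym (evalT-num (k ∷ₑ noEnv) (suc n)))))

R₀-sound : ∀ {φ} → R₀ φ → satᶜ noEnv φ
R₀-sound (ax+ m n)    = trans (cong₂ _+_ (evalT-num noEnv m) (evalT-num noEnv n)) (sym (evalT-num noEnv (m + n)))
R₀-sound (ax× m n)    = trans (cong₂ _*_ (evalT-num noEnv m) (evalT-num noEnv n)) (sym (evalT-num noEnv (m * n)))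
R₀-sound (ax≠ m n p)  = λ eq → p (trans (sym (evalT-num noEnv m)) (trans eq (evalT-num noEnv n)))
R₀-sound (ax≤ n)      = λ k k≤ → subst (satᶜ (k ∷ₑ noEnv)) (sym (bigOr-isNum≤ n))
                                   (isNum≤-complete k n (subst (k ≤_) (evalT-num (k ∷ₑ noEnv) n) k≤))
R₀-sound (ax≤' m n p) = subst₂ _≤_ (sym (evalT-num noEnv m)) (sym (evalT-num noEnv n)) p

-- Deciding bounded formulas in a theory

pure⇒bounded : ∀ {n} {φ : Formula n} → PureΔ₀ φ → Bounded φ
pure⇒bounded p⊥        = b⊥
pure⇒bounded (p≼ i j)   = b≼ _ _
pure⇒bounded (p≐ i j)   = b≐ _ _
pure⇒bounded (p0 i)     = b≐ _ _
pure⇒bounded (pS i j)   = b≐ _ _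
pure⇒bounded (p+ i j k) = b≐ _ _
pure⇒bounded (p× i j k) = b≐ _ _
pure⇒bounded (p⇒ p q)   = b⇒ (pure⇒bounded p) (pure⇒bounded q)
pure⇒bounded (p∧ p q)   = b∧ (pure⇒bounded p) (pure⇒bounded q)
pure⇒bounded (p∨ p q)   = b∨ (pure⇒bounded p) (pure⇒bounded q)
pure⇒bounded (p∀≤ i p)  = b∀≤ (var i) (pure⇒bounded p)
pure⇒bounded (p∃≤ i p)  = b∃≤ (var i) (pure⇒bounded p)
pure⇒bounded (p∀< i p)  = b∀< (var i) (pure⇒bounded p)
pure⇒bounded (p∃< i p)  = b∃< (var i) (pure⇒bounded p)

Bounded-renF : ∀ {a b} (r : Fin a → Fin b) {φ} → Bounded φ → Bounded (renF r φ)
Bounded-renF r b⊥       = b⊥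
Bounded-renF r (b≐ s t) = b≐ _ _
Bounded-renF r (b≼ s t) = b≼ _ _
Bounded-renF r (b⇒ b c) = b⇒ (Bounded-renF r b) (Bounded-renF r c)
Bounded-renF r (b∧ b c) = b∧ (Bounded-renF r b) (Bounded-renF r c)
Bounded-renF r (b∨ b c) = b∨ (Bounded-renF r b) (Bounded-renF r c)
Bounded-renF r (b∀≤ t b) rewrite wkT-renT r t = b∀≤ (renT r t) (Bounded-renF (liftR r) b)
Bounded-renF r (b∃≤ t b) rewrite wkT-renT r t = b∃≤ (renT r t) (Bounded-renF (liftR r) b)
Bounded-renF r (b∀< t b) rewrite wkT-renT r t = b∀< (renT r t) (Bounded-renF (liftR r) b)
Bounded-renF r (b∃< t b) rewrite wkT-renT r t = b∃< (renT r t) (Bounded-renF (liftR r) b)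

all⊎counterexample : ∀ {a b} {A : ℕ → Set a} {B : ℕ → Set b} v →
                     (∀ k → k < v → A k ⊎ B k) → (∀ k → k < v → A k) ⊎ ∃[ k ] (k < v × B k)
all⊎counterexample zero    h = inj₁ (λ k ())
all⊎counterexample (suc v) h with all⊎counterexample v (λ k k< → h k (m≤n⇒m≤1+n k<)) | h v ≤-refl
... | inj₂ (k , k< , b) | _     = inj₂ (k , m≤n⇒m≤1+n k< , b)
... | inj₁ f            | inj₂ b = inj₂ (v , ≤-refl , b)
... | inj₁ f            | inj₁ a = inj₁ g
  where
  g : ∀ k → k < suc v → _
  g k k<1+v with k ≟ v
  ... | yes refl = a
  ... | no k≢v   = f k (≤∧≢⇒< (≤-pred k<1+v) k≢v)

Decides : ∀ {m} → List (Formula m) → Set → Formula m → Set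
Decides Δ S φ = (S × (Δ ⊢ φ)) ⊎ (¬ S × (Δ ⊢ ¬' φ))

record BoundFacts {n m} (Δ : List (Formula m)) (t : Term n) (e : Fin n → ℕ) : Set where
  field
    value    : Δ ⊢ subT ⌜ e ⌝ t ≐ num (evalT e t)
    le-axiom : Δ ⊢ leAxiom (evalT e t)
    below    : ∀ i → i ≤ evalT e t → Δ ⊢ num i ≼ num (evalT e t)
    distinct : ∀ i → i < evalT e t → Δ ⊢ ¬' (num i ≐ num (evalT e t))

Decisive : ∀ {n m} → List (Formula m) → {φ : Formula n} → Bounded φ → (Fin n → ℕ) → Set
Decisive Δ b⊥        e = ⊤
Decisive Δ (b≐ s t)  e = Decides Δ (sat e (s ≐ t)) (subF ⌜ e ⌝ (s ≐ t))
Decisive Δ (b≼ s t)  e = Decides Δ (sat e (s ≼ t)) (subF ⌜ e ⌝ (s ≼ t))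
Decisive Δ (b⇒ b c)  e = Decisive Δ b e × Decisive Δ c e
Decisive Δ (b∧ b c)  e = Decisive Δ b e × Decisive Δ c e
Decisive Δ (b∨ b c)  e = Decisive Δ b e × Decisive Δ c e
Decisive Δ (b∀≤ t b) e = BoundFacts Δ t e × (∀ k → k ≤ evalT e t → Decisive Δ b (k ∷ₑ e))
Decisive Δ (b∃≤ t b) e = BoundFacts Δ t e × (∀ k → k ≤ evalT e t → Decisive Δ b (k ∷ₑ e))
Decisive Δ (b∀< t b) e = BoundFacts Δ t e × (∀ k → k < evalT e t → Decisive Δ b (k ∷ₑ e))
Decisive Δ (b∃< t b) e = BoundFacts Δ t e × (∀ k → k < evalT e t → Decisive Δ b (k ∷ₑ e))

module BoundedQuantifier {n m} {Δ : List (Formula m)} (e : Fin n → ℕ) (t : Term n)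
                         (φ : Formula (suc n)) (facts : BoundFacts Δ t e) where
  open BoundFacts facts

  v : ℕ
  v = evalT e t

  φ⟨_⟩ : ∀ {l} → ℕ → Formula l
  φ⟨ k ⟩ = subF ⌜ k ∷ₑ e ⌝ φ

  body : ∀ {l} → Formula (suc l)
  body = subF (liftS ⌜ e ⌝) φ

  bound : Term (suc m)
  bound = subT (liftS ⌜ e ⌝) (wkT t)

  Δ′ : List (Formula (suc m))
  Δ′ = map wkF Δ

  bound-value : Δ′ ⊢ bound ≐ num v
  bound-value = retype (cong₂ _≐_ (sym (liftS-wkT ⌜ e ⌝ t)) (renT-num suc v)) (weakenVar value)

  bound-[] : ∀ u → subT (sub0 u) bound ≡ subT ⌜ e ⌝ t
  bound-[] = liftS-bound ⌜ e ⌝ t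

  wk-instance : ∀ {k} → Δ ⊢ φ⟨ k ⟩ → Δ′ ⊢ φ⟨ k ⟩
  wk-instance d = retype (renF-⌜⌝ suc _ φ) (weakenVar d)

  wk-¬instance : ∀ {k} → Δ ⊢ ¬' φ⟨ k ⟩ → Δ′ ⊢ ¬' φ⟨ k ⟩
  wk-¬instance d = retype (cong ¬'_ (renF-⌜⌝ suc _ φ)) (weakenVar d)

  body-var : ∀ {l} → body {suc l} [ var zero ] ≡ body {l}
  body-var = subF-subF h φ
    where
    h : ∀ i → subT (sub0 (var zero)) (liftS ⌜ e ⌝ i) ≡ liftS ⌜ e ⌝ i
    h zero    = refl
    h (suc i) = trans (sub0-wkT _ _) (sym (renT-num suc (e i)))

  body-num : ∀ {l} k → body {l} [ num k ] ≡ φ⟨ k ⟩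
  body-num = liftS-⌜⌝-[] e φ

  ≼bound⇒isNum≤ : ∀ {Γ} → Δ′ ⊆ Γ → Γ ⊢ var zero ≼ bound → Γ ⊢ isNum≤ (var zero) v
  ≼bound⇒isNum≤ inc d =
    leAxiom-elim (weaken inc (retype (renF-leAxiom suc v) (weakenVar le-axiom)))
                 (≼-respʳ-≐ d (weaken inc bound-value))

  ≐num⇒body : ∀ {l} {Γ : List (Formula (suc l))} {i} → Γ ⊢ var zero ≐ num i → Γ ⊢ φ⟨ i ⟩ → Γ ⊢ body
  ≐num⇒body eq d = transport body (≐-sym eq) d (body-num _) body-var

  ≐num⇒instance : ∀ {l} {Γ : List (Formula (suc l))} {i} → Γ ⊢ var zero ≐ num i → Γ ⊢ body → Γ ⊢ φ⟨ i ⟩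
  ≐num⇒instance eq d = transport body eq d body-var (body-num _)

  num≼t : ∀ {k} → k ≤ v → Δ ⊢ num k ≼ subT ⌜ e ⌝ t
  num≼t k≤ = ≼-respʳ-≐ (below _ k≤) (≐-sym value)

  num≺t : ∀ {k} → k < v → Δ ⊢ num k ≺ subT ⌜ e ⌝ t
  num≺t k< = ∧I (num≼t (<⇒≤ k<))
                (⇒I (⇒E (weaken₁ (distinct _ k<)) (≐-trans (hyp (here refl)) (weaken₁ value))))

  ≐bound-absurd : ∀ {Γ} → Δ′ ⊆ Γ → Γ ⊢ ¬' (var zero ≐ bound) → Γ ⊢ var zero ≐ num v → Γ ⊢ ⊥'
  ≐bound-absurd inc d eq = ⇒E d (≐-trans eq (≐-sym (weaken inc bound-value)))

  all≤ : (∀ k → k ≤ v → Δ ⊢ φ⟨ k ⟩) → Δ ⊢ subF ⌜ e ⌝ (∀≤ t φ)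
  all≤ h = ∀I (⇒I (isNum≤-elim v (≼bound⇒isNum≤ (xs⊆x∷xs _ _) (hyp (here refl)))
    (λ i i≤ → ⇒I (≐num⇒body (hyp (here refl)) (weaken₁ (weaken₁ (wk-instance (h i i≤))))))))

  counterexample≤ : ∀ k → k ≤ v → Δ ⊢ ¬' φ⟨ k ⟩ → Δ ⊢ ¬' subF ⌜ e ⌝ (∀≤ t φ)
  counterexample≤ k k≤ d = ⇒I (⇒E (weaken₁ d)
    (⇒E (retype (cong₂ _⇒_ (cong (num k ≼_) (bound-[] (num k))) (body-num k)) (∀E (hyp (here refl)) (num k)))
        (weaken₁ (num≼t k≤))))

  witness≤ : ∀ k → k ≤ v → Δ ⊢ φ⟨ k ⟩ → Δ ⊢ subF ⌜ e ⌝ (∃≤ t φ)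
  witness≤ k k≤ d = ∃I (num k)
    (retype (sym (cong₂ _∧'_ (cong (num k ≼_) (bound-[] (num k))) (body-num k))) (∧I (num≼t k≤) d))

  none≤ : (∀ k → k ≤ v → Δ ⊢ ¬' φ⟨ k ⟩) → Δ ⊢ ¬' subF ⌜ e ⌝ (∃≤ t φ)
  none≤ h = ⇒I (∃E (hyp (here refl))
    (isNum≤-elim v (≼bound⇒isNum≤ (⊆-there (xs⊆x∷xs _ _)) (∧E₁ (hyp (here refl))))
      (λ i i≤ → ⇒I (⇒E (weaken (⊆-there (⊆-there (⊆-there ⊆-refl))) (wk-¬instance (h i i≤)))
                       (≐num⇒instance (hyp (here refl)) (∧E₂ (hyp (there (here refl)))))))))

  all< : (∀ k → k < v → Δ ⊢ φ⟨ k ⟩) → Δ ⊢ subF ⌜ e ⌝ (∀< t φ)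
  all< h = ∀I (⇒I (isNum≤-elim v (≼bound⇒isNum≤ (xs⊆x∷xs _ _) (∧E₁ (hyp (here refl)))) case))
    where
    case : ∀ i → i ≤ v → _
    case i i≤ with i ≟ v
    ... | yes refl = ⇒I (⊥E (≐bound-absurd (⊆-there (xs⊆x∷xs _ _)) (∧E₂ (hyp (there (here refl))))
                                             (hyp (here refl))))
    ... | no i≢v   = ⇒I (≐num⇒body (hyp (here refl))
                                    (weaken₁ (weaken₁ (wk-instance (h i (≤∧≢⇒< i≤ i≢v))))))

  counterexample< : ∀ k → k < v → Δ ⊢ ¬' φ⟨ k ⟩ → Δ ⊢ ¬' subF ⌜ e ⌝ (∀< t φ)
  counterexample< k k< d = ⇒I (⇒E (weaken₁ d)
    (⇒E (retype (cong₂ _⇒_ (cong₂ (λ a b → (num k ≼ a) ∧' ¬' (num k ≐ b)) (bound-[] (num k)) (bound-[] (num k)))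
                           (body-num k))
                (∀E (hyp (here refl)) (num k)))
        (weaken₁ (num≺t k<))))

  witness< : ∀ k → k < v → Δ ⊢ φ⟨ k ⟩ → Δ ⊢ subF ⌜ e ⌝ (∃< t φ)
  witness< k k< d = ∃I (num k)
    (retype (sym (cong₂ _∧'_ (cong₂ (λ a b → (num k ≼ a) ∧' ¬' (num k ≐ b)) (bound-[] (num k)) (bound-[] (num k)))
                             (body-num k)))
            (∧I (num≺t k<) d))

  none< : (∀ k → k < v → Δ ⊢ ¬' φ⟨ k ⟩) → Δ ⊢ ¬' subF ⌜ e ⌝ (∃< t φ)
  none< h = ⇒I (∃E (hyp (here refl))
    (isNum≤-elim v (≼bound⇒isNum≤ (⊆-there (xs⊆x∷xs _ _)) (∧E₁ (∧E₁ (hyp (here refl))))) case))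
    where
    case : ∀ i → i ≤ v → _
    case i i≤ with i ≟ v
    ... | yes refl = ⇒I (≐bound-absurd (⊆-there (⊆-there (xs⊆x∷xs _ _)))
                                        (∧E₂ (∧E₁ (hyp (there (here refl))))) (hyp (here refl)))
    ... | no i≢v   = ⇒I (⇒E (weaken (⊆-there (⊆-there (⊆-there ⊆-refl))) (wk-¬instance (h i (≤∧≢⇒< i≤ i≢v))))
                            (≐num⇒instance (hyp (here refl)) (∧E₂ (hyp (there (here refl))))))

decide : ∀ {n m} {Δ : List (Formula m)} {φ : Formula n} (b : Bounded φ) (e : Fin n → ℕ) →
         Decisive Δ b e → Decides Δ (sat e φ) (subF ⌜ e ⌝ φ)
decide b⊥       e _ = inj₂ ((λ x → x) , ⇒I (hyp (here refl)))
decide (b≐ s t) e d = d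
decide (b≼ s t) e d = d
decide (b⇒ b c) e (db , dc) with decide b e db | decide c e dc
... | inj₁ (x , d) | inj₁ (y , d′) = inj₁ ((λ _ → y) , ⇒I (weaken₁ d′))
... | inj₁ (x , d) | inj₂ (¬y , d′) =
  inj₂ ((λ f → ¬y (f x)) , ⇒I (⇒E (weaken₁ d′) (⇒E (hyp (here refl)) (weaken₁ d))))
... | inj₂ (¬x , d) | _ = inj₁ ((λ x → ⊥-elim (¬x x)) , ⇒I (⊥E (⇒E (weaken₁ d) (hyp (here refl)))))
decide (b∧ b c) e (db , dc) with decide b e db | decide c e dc
... | inj₁ (x , d) | inj₁ (y , d′) = inj₁ ((x , y) , ∧I d d′)
... | inj₂ (¬x , d) | _ = inj₂ ((λ (x , _) → ¬x x) , ⇒I (⇒E (weaken₁ d) (∧E₁ (hyp (here refl)))))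
... | inj₁ _ | inj₂ (¬y , d′) = inj₂ ((λ (_ , y) → ¬y y) , ⇒I (⇒E (weaken₁ d′) (∧E₂ (hyp (here refl)))))
decide (b∨ b c) e (db , dc) with decide b e db | decide c e dc
... | inj₁ (x , d) | _ = inj₁ (inj₁ x , ∨I₁ d)
... | inj₂ _ | inj₁ (y , d′) = inj₁ (inj₂ y , ∨I₂ d′)
... | inj₂ (¬x , d) | inj₂ (¬y , d′) =
  inj₂ ([ ¬x , ¬y ]′ , ⇒I (∨E (hyp (here refl)) (⇒E (weaken₁ (weaken₁ d)) (hyp (here refl)))
                                                 (⇒E (weaken₁ (weaken₁ d′)) (hyp (here refl)))))
decide (b∀≤ t {φ} b) e (facts , db)
  with all⊎counterexample (suc (evalT e t)) (λ k k< → decide b (k ∷ₑ e) (db k (≤-pred k<)))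
... | inj₁ f = inj₁ ((λ k k≤ → proj₁ (f k (s≤s (to (sat-≼-bound k e t) k≤)))) ,
                    BoundedQuantifier.all≤ e t φ facts (λ k k≤ → proj₂ (f k (s≤s k≤))))
... | inj₂ (k , k< , ¬x , d) = inj₂ ((λ f → ¬x (f k (from (sat-≼-bound k e t) (≤-pred k<)))) ,
                                    BoundedQuantifier.counterexample≤ e t φ facts k (≤-pred k<) d)
decide (b∃≤ t {φ} b) e (facts , db)
  with all⊎counterexample (suc (evalT e t)) (λ k k< → swap (decide b (k ∷ₑ e) (db k (≤-pred k<))))
... | inj₁ f = inj₂ ((λ (k , k≤ , x) → proj₁ (f k (s≤s (to (sat-≼-bound k e t) k≤))) x) ,
                    BoundedQuantifier.none≤ e t φ facts (λ k k≤ → proj₂ (f k (s≤s k≤))))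
... | inj₂ (k , k< , x , d) = inj₁ ((k , from (sat-≼-bound k e t) (≤-pred k<) , x) ,
                                   BoundedQuantifier.witness≤ e t φ facts k (≤-pred k<) d)
decide (b∀< t {φ} b) e (facts , db)
  with all⊎counterexample (evalT e t) (λ k k< → decide b (k ∷ₑ e) (db k k<))
... | inj₁ f = inj₁ ((λ k k< → proj₁ (f k (to (sat-≺-bound k e t) k<))) ,
                    BoundedQuantifier.all< e t φ facts (λ k k< → proj₂ (f k k<)))
... | inj₂ (k , k< , ¬x , d) = inj₂ ((λ f → ¬x (f k (from (sat-≺-bound k e t) k<))) ,
                                    BoundedQuantifier.counterexample< e t φ facts k k< d)
decide (b∃< t {φ} b) e (facts , db)
  with all⊎counterexample (evalT e t) (λ k k< → swap (decide b (k ∷ₑ e) (db k k<)))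
... | inj₁ f = inj₂ ((λ (k , k< , x) → proj₁ (f k (to (sat-≺-bound k e t) k<)) x) ,
                    BoundedQuantifier.none< e t φ facts (λ k k< → proj₂ (f k k<)))
... | inj₂ (k , k< , x , d) = inj₁ ((k , from (sat-≺-bound k e t) k< , x) ,
                                   BoundedQuantifier.witness< e t φ facts k k< d)

record ArithUpTo {m} (Δ : List (Formula m)) (B : ℕ) : Set where
  field
    plus  : ∀ i j → i ≤ B → j ≤ B → Δ ⊢ num i `+ num j ≐ num (i + j)
    times : ∀ i j → i ≤ B → j ≤ B → Δ ⊢ num i `× num j ≐ num (i * j)
    apart : ∀ i j → i ≤ B → j ≤ B → i ≢ j → Δ ⊢ ¬' (num i ≐ num j)
    leAx  : ∀ j → j ≤ B → Δ ⊢ leAxiom j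
    le    : ∀ i j → i ≤ j → j ≤ B → Δ ⊢ num i ≼ num j
open ArithUpTo

ArithUpTo-rename : ∀ {a b} (r : Fin a → Fin b) {Δ B} → ArithUpTo Δ B → ArithUpTo (map (renF r) Δ) B
ArithUpTo-rename r A .plus i j p q =
  retype (cong₂ _≐_ (cong₂ _`+_ (renT-num r i) (renT-num r j)) (renT-num r _)) (rename r (plus A i j p q))
ArithUpTo-rename r A .times i j p q =
  retype (cong₂ _≐_ (cong₂ _`×_ (renT-num r i) (renT-num r j)) (renT-num r _)) (rename r (times A i j p q))
ArithUpTo-rename r A .apart i j p q i≢j =
  retype (cong ¬'_ (cong₂ _≐_ (renT-num r i) (renT-num r j))) (rename r (apart A i j p q i≢j))
ArithUpTo-rename r A .leAx j p = retype (renF-leAxiom r j) (rename r (leAx A j p))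
ArithUpTo-rename r A .le i j p q = retype (cong₂ _≼_ (renT-num r i) (renT-num r j)) (rename r (le A i j p q))

ArithUpTo-weaken : ∀ {m} {Δ Δ′ : List (Formula m)} {B} → Δ ⊆ Δ′ → ArithUpTo Δ B → ArithUpTo Δ′ B
ArithUpTo-weaken h A .plus i j p q    = weaken h (plus A i j p q)
ArithUpTo-weaken h A .times i j p q   = weaken h (times A i j p q)
ArithUpTo-weaken h A .apart i j p q n = weaken h (apart A i j p q n)
ArithUpTo-weaken h A .leAx j p        = weaken h (leAx A j p)
ArithUpTo-weaken h A .le i j p q      = weaken h (le A i j p q)

ArithUpTo-mono : ∀ {m} {Δ : List (Formula m)} {B B′} → B′ ≤ B → ArithUpTo Δ B → ArithUpTo Δ B′
ArithUpTo-mono h A .plus i j p q    = plus A i j (≤-trans p h) (≤-trans q h)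
ArithUpTo-mono h A .times i j p q   = times A i j (≤-trans p h) (≤-trans q h)
ArithUpTo-mono h A .apart i j p q n = apart A i j (≤-trans p h) (≤-trans q h) n
ArithUpTo-mono h A .leAx j p        = leAx A j (≤-trans p h)
ArithUpTo-mono h A .le i j p q      = le A i j p (≤-trans q h)

termBound : ∀ {n} → (Fin n → ℕ) → Term n → ℕ
termBound e (var i)  = e i
termBound e `0       = 0
termBound e (`S t)   = suc (termBound e t)
termBound e (s `+ t) = (termBound e s ⊔ termBound e t) ⊔ (evalT e s + evalT e t)
termBound e (s `× t) = (termBound e s ⊔ termBound e t) ⊔ (evalT e s * evalT e t)

evalT≤termBound : ∀ {n} (e : Fin n → ℕ) t → evalT e t ≤ termBound e t
evalT≤termBound e (var i)  = ≤-refl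
evalT≤termBound e `0       = z≤n
evalT≤termBound e (`S t)   = s≤s (evalT≤termBound e t)
evalT≤termBound e (s `+ t) = m≤n⊔m _ _
evalT≤termBound e (s `× t) = m≤n⊔m _ _

max≤ : (ℕ → ℕ) → ℕ → ℕ
max≤ f zero    = f zero
max≤ f (suc v) = max≤ f v ⊔ f (suc v)

≤max≤ : ∀ f {k} v → k ≤ v → f k ≤ max≤ f v
≤max≤ f {zero} zero z≤n = ≤-refl
≤max≤ f {k} (suc v) k≤ with k ≟ suc v
... | yes refl = m≤n⊔m _ _
... | no k≢    = ≤-trans (≤max≤ f v (≤-pred (≤∧≢⇒< k≤ k≢))) (m≤m⊔n _ _)

formulaBound : ∀ {n} {φ : Formula n} → Bounded φ → (Fin n → ℕ) → ℕ
formulaBound b⊥        e = 0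
formulaBound (b≐ s t)  e = termBound e s ⊔ termBound e t
formulaBound (b≼ s t)  e = termBound e s ⊔ termBound e t
formulaBound (b⇒ b c)  e = formulaBound b e ⊔ formulaBound c e
formulaBound (b∧ b c)  e = formulaBound b e ⊔ formulaBound c e
formulaBound (b∨ b c)  e = formulaBound b e ⊔ formulaBound c e
formulaBound (b∀≤ t b) e = termBound e t ⊔ max≤ (λ k → formulaBound b (k ∷ₑ e)) (evalT e t)
formulaBound (b∃≤ t b) e = termBound e t ⊔ max≤ (λ k → formulaBound b (k ∷ₑ e)) (evalT e t)
formulaBound (b∀< t b) e = termBound e t ⊔ max≤ (λ k → formulaBound b (k ∷ₑ e)) (evalT e t)
formulaBound (b∃< t b) e = termBound e t ⊔ max≤ (λ k → formulaBound b (k ∷ₑ e)) (evalT e t)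

⊔≤⇒ˡ : ∀ {a b B} → a ⊔ b ≤ B → a ≤ B
⊔≤⇒ˡ {a} {b} = ≤-trans (m≤m⊔n a b)

⊔≤⇒ʳ : ∀ {a b B} → a ⊔ b ≤ B → b ≤ B
⊔≤⇒ʳ {a} {b} = ≤-trans (m≤n⊔m a b)

module FromArith {m} {Δ : List (Formula m)} {B} (A : ArithUpTo Δ B) where

  value : ∀ {n} (t : Term n) e → termBound e t ≤ B → Δ ⊢ subT ⌜ e ⌝ t ≐ num (evalT e t)
  value (var i)  e p = ≐refl _
  value `0       e p = ≐refl _
  value (`S t)   e p = ≐-congS (value t e (≤-trans (n≤1+n _) p))
  value (s `+ t) e p = ≐-trans (≐-cong+ (value s e (⊔≤⇒ˡ p′)) (value t e (⊔≤⇒ʳ p′)))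
    (plus A _ _ (≤-trans (evalT≤termBound e s) (⊔≤⇒ˡ p′)) (≤-trans (evalT≤termBound e t) (⊔≤⇒ʳ p′)))
    where p′ = ⊔≤⇒ˡ p
  value (s `× t) e p = ≐-trans (≐-cong× (value s e (⊔≤⇒ˡ p′)) (value t e (⊔≤⇒ʳ p′)))
    (times A _ _ (≤-trans (evalT≤termBound e s) (⊔≤⇒ˡ p′)) (≤-trans (evalT≤termBound e t) (⊔≤⇒ʳ p′)))
    where p′ = ⊔≤⇒ˡ p

  value≤ : ∀ {n} (t : Term n) e → termBound e t ≤ B → evalT e t ≤ B
  value≤ t e = ≤-trans (evalT≤termBound e t)

  decide-≐ : ∀ {n} (s t : Term n) e → termBound e s ⊔ termBound e t ≤ B →
             Decides Δ (sat e (s ≐ t)) (subF ⌜ e ⌝ (s ≐ t))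
  decide-≐ s t e p = by-value (evalT e s ≟ evalT e t)
    where
    ⊢s = value s e (⊔≤⇒ˡ p)
    ⊢t = value t e (⊔≤⇒ʳ p)
    by-value : Dec (evalT e s ≡ evalT e t) → Decides Δ (sat e (s ≐ t)) (subF ⌜ e ⌝ (s ≐ t))
    by-value (yes s≡t) = inj₁ (s≡t , ≐-trans ⊢s (subst (λ k → Δ ⊢ num k ≐ _) (sym s≡t) (≐-sym ⊢t)))
    by-value (no s≢t)  = inj₂ (s≢t , ⇒I (⇒E
      (weaken₁ (apart A _ _ (value≤ s e (⊔≤⇒ˡ p)) (value≤ t e (⊔≤⇒ʳ p)) s≢t))
      (≐-trans (≐-trans (≐-sym (weaken₁ ⊢s)) (hyp (here refl))) (weaken₁ ⊢t))))

  decide-≼ : ∀ {n} (s t : Term n) e → termBound e s ⊔ termBound e t ≤ B →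
             Decides Δ (sat e (s ≼ t)) (subF ⌜ e ⌝ (s ≼ t))
  decide-≼ s t e p = by-value (evalT e s ≤? evalT e t)
    where
    ⊢s = value s e (⊔≤⇒ˡ p)
    ⊢t = value t e (⊔≤⇒ʳ p)
    t≤B = value≤ t e (⊔≤⇒ʳ p)
    by-value : Dec (evalT e s ≤ evalT e t) → Decides Δ (sat e (s ≼ t)) (subF ⌜ e ⌝ (s ≼ t))
    by-value (yes s≤t) = inj₁ (s≤t , ≼-respˡ-≐ (≼-respʳ-≐ (le A _ _ s≤t t≤B) (≐-sym ⊢t)) (≐-sym ⊢s))
    by-value (no s≰t)  = inj₂ (s≰t , ⇒I (isNum≤-elim (evalT e t)
      (leAxiom-elim (weaken₁ (leAx A _ t≤B))
                    (≼-respˡ-≐ (≼-respʳ-≐ (hyp (here refl)) (weaken₁ ⊢t)) (weaken₁ ⊢s)))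
      (λ i i≤ → weaken₁ (apart A _ _ (value≤ s e (⊔≤⇒ˡ p)) (≤-trans i≤ t≤B)
                                  (λ eq → s≰t (subst (_≤ evalT e t) (sym eq) i≤))))))

  boundFacts : ∀ {n} (t : Term n) e → termBound e t ≤ B → BoundFacts Δ t e
  boundFacts t e p = record
    { value    = value t e p
    ; le-axiom = leAx A _ (value≤ t e p)
    ; below    = λ i i≤ → le A i _ i≤ (value≤ t e p)
    ; distinct = λ i i< → apart A _ _ (≤-trans (<⇒≤ i<) (value≤ t e p)) (value≤ t e p) (λ eq → <-irrefl eq i<)
    }

  inner-bound : ∀ {n} {φ : Formula (suc n)} (b : Bounded φ) t e →
                termBound e t ⊔ max≤ (λ k → formulaBound b (k ∷ₑ e)) (evalT e t) ≤ B →
                ∀ {k} → k ≤ evalT e t → formulaBound b (k ∷ₑ e) ≤ B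
  inner-bound b t e p k≤ = ≤-trans (≤max≤ (λ k → formulaBound b (k ∷ₑ e)) _ k≤) (⊔≤⇒ʳ p)

  decisive : ∀ {n} {φ : Formula n} (b : Bounded φ) e → formulaBound b e ≤ B → Decisive Δ b e
  decisive b⊥        e p = tt
  decisive (b≐ s t)  e p = decide-≐ s t e p
  decisive (b≼ s t)  e p = decide-≼ s t e p
  decisive (b⇒ b c)  e p = decisive b e (⊔≤⇒ˡ p) , decisive c e (⊔≤⇒ʳ p)
  decisive (b∧ b c)  e p = decisive b e (⊔≤⇒ˡ p) , decisive c e (⊔≤⇒ʳ p)
  decisive (b∨ b c)  e p = decisive b e (⊔≤⇒ˡ p) , decisive c e (⊔≤⇒ʳ p)
  decisive (b∀≤ t b) e p = boundFacts t e (⊔≤⇒ˡ p) , λ k k≤ → decisive b (k ∷ₑ e) (inner-bound b t e p k≤)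
  decisive (b∃≤ t b) e p = boundFacts t e (⊔≤⇒ˡ p) , λ k k≤ → decisive b (k ∷ₑ e) (inner-bound b t e p k≤)
  decisive (b∀< t b) e p = boundFacts t e (⊔≤⇒ˡ p) , λ k k< → decisive b (k ∷ₑ e) (inner-bound b t e p (<⇒≤ k<))
  decisive (b∃< t b) e p = boundFacts t e (⊔≤⇒ˡ p) , λ k k< → decisive b (k ∷ₑ e) (inner-bound b t e p (<⇒≤ k<))

  decides : ∀ {n} {φ : Formula n} (b : Bounded φ) e → formulaBound b e ≤ B →
            Decides Δ (sat e φ) (subF ⌜ e ⌝ φ)
  decides b e p = decide b e (decisive b e p)

axiomBound : ∀ {φ} → R₀ φ → ℕ
axiomBound (ax+ m n)    = m ⊔ n
axiomBound (ax× m n)    = m ⊔ n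
axiomBound (ax≠ m n _)  = m ⊔ n
axiomBound (ax≤ n)      = n
axiomBound (ax≤' m n _) = n

axiomsBound : ∀ {Γ} → All R₀ Γ → ℕ
axiomsBound []       = 0
axiomsBound (r ∷ rs) = axiomBound r ⊔ axiomsBound rs

axiom-within : ∀ {Γ ψ} (rs : All R₀ Γ) → ψ ∈ Γ → Σ (R₀ ψ) (λ r → axiomBound r ≤ axiomsBound rs)
axiom-within (r ∷ rs) (here refl) = r , m≤m⊔n _ _
axiom-within (r ∷ rs) (there p) with axiom-within rs p
... | r′ , r′≤ = r′ , ≤-trans r′≤ (m≤n⊔m _ _)

R₀-axiom-from-arith : ∀ {Γ : List (Formula 1)} {B} → ArithUpTo Γ B →
                      ∀ {ψ} (r : R₀ ψ) → axiomBound r ≤ B → Γ ⊢ wkF ψ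
R₀-axiom-from-arith A (ax+ m n) p =
  retype (sym (cong₂ _≐_ (cong₂ _`+_ (renT-num _ m) (renT-num _ n)) (renT-num _ (m + n))))
         (plus A m n (⊔≤⇒ˡ p) (⊔≤⇒ʳ p))
R₀-axiom-from-arith A (ax× m n) p =
  retype (sym (cong₂ _≐_ (cong₂ _`×_ (renT-num _ m) (renT-num _ n)) (renT-num _ (m * n))))
         (times A m n (⊔≤⇒ˡ p) (⊔≤⇒ʳ p))
R₀-axiom-from-arith A (ax≠ m n m≢n) p =
  retype (sym (cong ¬'_ (cong₂ _≐_ (renT-num _ m) (renT-num _ n))))
         (apart A m n (⊔≤⇒ˡ p) (⊔≤⇒ʳ p) m≢n)
R₀-axiom-from-arith A (ax≤ n) p =
  retype (sym (trans (cong (renF _) (cong (λ φ → ∀' ((var zero ≼ num n) ⇒ φ)) (bigOr-isNum≤ n)))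
                     (renF-leAxiom _ n)))
         (leAx A n p)
R₀-axiom-from-arith A (ax≤' m n m≤n) p = retype (sym (cong₂ _≼_ (renT-num _ m) (renT-num _ n))) (le A m n m≤n p)

record AtLeast {m} (Δ : List (Formula (suc m))) (K : ℕ) : Set where
  field
    ≼-var : ∀ i → i ≤ K → Δ ⊢ num i ≼ var zero
    ≢-var : ∀ i → i < K → Δ ⊢ ¬' (num i ≐ var zero)
open AtLeast

AtLeast-weaken : ∀ {m} {Δ Δ′ : List (Formula (suc m))} {K} → Δ ⊆ Δ′ → AtLeast Δ K → AtLeast Δ′ K
AtLeast-weaken h a = record { ≼-var = λ i i≤ → weaken h (≼-var a i i≤)
                            ; ≢-var = λ i i< → weaken h (≢-var a i i<) }

successorClosed : ∀ {m} → Formula (suc m)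
successorClosed = ∀< (var zero) (`S (var zero) ≼ var (suc zero))

AtLeast-suc : ∀ {m} {Δ : List (Formula (suc m))} {K} → Δ ⊢ successorClosed → AtLeast Δ K →
              AtLeast (¬' (num K ≐ var zero) ∷ Δ) (suc K)
AtLeast-suc {K = K} sc a = record { ≼-var = ≼var ; ≢-var = ≢var }
  where
  ≼var : ∀ i → i ≤ suc K → _
  ≼var i i≤ with m≤n⇒m<n∨m≡n i≤
  ... | inj₁ i<  = weaken₁ (≼-var a i (≤-pred i<))
  ... | inj₂ refl = ⇒E (∀E (weaken₁ sc) (num K)) (∧I (weaken₁ (≼-var a K ≤-refl)) (hyp (here refl)))
  ≢var : ∀ i → i < suc K → _
  ≢var i i< with m≤n⇒m<n∨m≡n (≤-pred i<)
  ... | inj₁ i<K  = weaken₁ (≢-var a i i<K)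
  ... | inj₂ refl = hyp (here refl)

-- The two hypotheses say wb(var zero).
numeral-cases : ∀ {m} {Γ : List (Formula (suc m))} {χ} n →
  Γ ⊢ `0 ≼ var zero → Γ ⊢ successorClosed →
  (∀ {Δ} j → j < n → Γ ⊆ Δ → AtLeast Δ j → Δ ⊢ num j ≐ var zero → Δ ⊢ χ) →
  (∀ {Δ} → Γ ⊆ Δ → AtLeast Δ n → Δ ⊢ χ) →
  Γ ⊢ χ
numeral-cases zero z sc numeral above =
  above ⊆-refl (record { ≼-var = λ { zero z≤n → z } ; ≢-var = λ i () })
numeral-cases (suc n) z sc numeral above =
  numeral-cases n z sc (λ j j< → numeral j (m≤n⇒m≤1+n j<)) λ Γ⊆Δ a →
    by-cases (num n ≐ var zero)
      (numeral n ≤-refl (⊆-there Γ⊆Δ) (AtLeast-weaken (xs⊆x∷xs _ _) a) (hyp (here refl)))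
      (above (⊆-there Γ⊆Δ) (AtLeast-suc (weaken Γ⊆Δ sc) a))

-- The certificate

zeroMinimal : ∀ {m} → Formula m
zeroMinimal = ∀' ((var zero ≼ `0) ⇔' (var zero ≐ `0))

≼S-split : ∀ {m} → Formula (suc (suc m))
≼S-split = (var zero ≼ `S (var (suc zero))) ⇔' ((var zero ≼ var (suc zero)) ∨' (var zero ≐ `S (var (suc zero))))

module Ordering {m} {Γ : List (Formula m)} (i : Fin m)
                (c₃ : Γ ⊢ zeroMinimal) (c₄ : Γ ⊢ ∀< (var i) (∀' ≼S-split)) (K : ℕ)
                (below : ∀ y → y < K → Γ ⊢ num y ≺ var i) where

  ≼0 : ∀ u → Γ ⊢ (u ≼ `0) ⇔' (u ≐ `0)
  ≼0 u = inst-∀ var ((var zero ≼ `0) ⇔' (var zero ≐ `0)) (subF-var zeroMinimal c₃) u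

  ≼S : ∀ y → y < K → ∀ u → Γ ⊢ (u ≼ `S (num y)) ⇔' ((u ≼ num y) ∨' (u ≐ `S (num y)))
  ≼S y y< u = inst-∀ (num y ∷ₛ var) ≼S-split
    (inst-∀< var (var i) (∀' ≼S-split) (subF-var (∀< (var i) (∀' ≼S-split)) c₄)
             (∧E₁ (below y y<)) (∧E₂ (below y y<))) u

  ≼num⇒isNum≤ : ∀ u j → j ≤ K → Γ ⊢ (u ≼ num j) ⇒ isNum≤ u j
  ≼num⇒isNum≤ u zero    j≤ = ∧E₁ (≼0 u)
  ≼num⇒isNum≤ u (suc j) j≤ = ⇒I (∨E (⇒E (weaken₁ (∧E₁ (≼S j j≤ u))) (hyp (here refl)))
    (∨I₁ (⇒E (weaken₁ (weaken₁ (≼num⇒isNum≤ u j (≤-trans (n≤1+n j) j≤)))) (hyp (here refl))))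
    (∨I₂ (hyp (here refl))))

  ≼-numerals : ∀ a b → a ≤ b → b ≤ K → Γ ⊢ num a ≼ num b
  ≼-numerals zero zero a≤b b≤ = ⇒E (∧E₂ (≼0 `0)) (≐refl `0)
  ≼-numerals a (suc b) a≤b b≤ with m≤n⇒m<n∨m≡n a≤b
  ... | inj₁ a<  = ⇒E (∧E₂ (≼S b b≤ (num a))) (∨I₁ (≼-numerals a b (≤-pred a<) (≤-trans (n≤1+n b) b≤)))
  ... | inj₂ refl = ⇒E (∧E₂ (≼S b b≤ (num a))) (∨I₂ (≐refl _))

  ⋠-numerals : ∀ a b → b < a → b ≤ K → (∀ c → c ≤ b → Γ ⊢ ¬' (num a ≐ num c)) → Γ ⊢ ¬' (num a ≼ num b)
  ⋠-numerals a zero b<a b≤ apart =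
    ⇒I (⇒E (weaken₁ (apart 0 z≤n)) (⇒E (weaken₁ (∧E₁ (≼0 (num a)))) (hyp (here refl))))
  ⋠-numerals a (suc b) b<a b≤ apart = ⇒I (∨E (⇒E (weaken₁ (∧E₁ (≼S b b≤ (num a)))) (hyp (here refl)))
    (⇒E (weaken₁ (weaken₁ (⋠-numerals a b (≤-trans (n≤1+n _) b<a) (≤-trans (n≤1+n b) b≤)
                                          (λ c c≤ → apart c (≤-trans c≤ (n≤1+n b))))))
        (hyp (here refl)))
    (⇒E (weaken₁ (weaken₁ (apart (suc b) ≤-refl))) (hyp (here refl))))

-- The bodies of the arithmetical clauses of cert, with their bound variables free.
private
  S≢0-clause : Formula 4
  S≢0-clause = ¬' (`S (var (# 2) `× var (# 1) `+ var (# 0)) ≐ `0)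
  S-inj-clause : Formula 5
  S-inj-clause = (`S (var (# 3) `× var (# 2) `+ var (# 1)) ≐ `S (var (# 0)))
                 ⇒ (var (# 3) `× var (# 2) `+ var (# 1) ≐ var (# 0))
  +0-clause : Formula 3
  +0-clause = var (# 1) `× var (# 0) `+ `0 ≐ var (# 1) `× var (# 0)
  +S-clause : Formula 4
  +S-clause = var (# 2) `× var (# 1) `+ `S (var (# 0)) ≐ `S (var (# 2) `× var (# 1) `+ var (# 0))
  ×0-clause : Formula 2
  ×0-clause = var (# 0) `× `0 ≐ `0
  ×S-clause : Formula 3
  ×S-clause = var (# 1) `× `S (var (# 0)) ≐ var (# 1) `× var (# 0) `+ var (# 1)

cert-zero≼ : ∀ {Γ : List (Formula 1)} → Γ ⊢ cert → Γ ⊢ `0 ≼ var zero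
cert-zero≼ c = ∧E₁ c

cert-successorClosed : ∀ {Γ : List (Formula 1)} → Γ ⊢ cert → Γ ⊢ successorClosed
cert-successorClosed c = ∧E₁ (∧E₂ c)

module Cert {Γ : List (Formula 1)} (c : Γ ⊢ cert) {K : ℕ} (atLeast : AtLeast Γ K) where

  private
    v : Term 1
    v = var zero
    x≼ : ∀ {x} → x ≤ K → Γ ⊢ num x ≼ v
    x≼ = ≼-var atLeast _

  S≢0 : ∀ {x y z} → x ≤ K → y ≤ K → z ≤ K → Γ ⊢ ¬' (`S ((num x `× num y) `+ num z) ≐ `0)
  S≢0 {x} {y} hx hy hz = inst-∀≤ (num y ∷ₛ num x ∷ₛ var) (var (# 2)) S≢0-clause
    (inst-∀≤ (num x ∷ₛ var) (var (# 1)) (∀≤ (var (# 2)) S≢0-clause)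
      (inst-∀≤ var v (∀≤ (var (# 1)) (∀≤ (var (# 2)) S≢0-clause))
        (subF-var _ (∧E₁ (∧E₂ (∧E₂ (∧E₂ (∧E₂ c)))))) (x≼ hx)) (x≼ hy)) (x≼ hz)

  S-inj : ∀ {x y z w} → x ≤ K → y ≤ K → z ≤ K → w ≤ K →
          Γ ⊢ (`S ((num x `× num y) `+ num z) ≐ `S (num w)) ⇒ ((num x `× num y) `+ num z ≐ num w)
  S-inj {x} {y} {z} hx hy hz hw = inst-∀≤ (num z ∷ₛ num y ∷ₛ num x ∷ₛ var) (var (# 3)) S-inj-clause
    (inst-∀≤ (num y ∷ₛ num x ∷ₛ var) (var (# 2)) (∀≤ (var (# 3)) S-inj-clause)
      (inst-∀≤ (num x ∷ₛ var) (var (# 1)) (∀≤ (var (# 2)) (∀≤ (var (# 3)) S-inj-clause))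
        (inst-∀≤ var v (∀≤ (var (# 1)) (∀≤ (var (# 2)) (∀≤ (var (# 3)) S-inj-clause)))
          (subF-var _ (∧E₁ (∧E₂ (∧E₂ (∧E₂ (∧E₂ (∧E₂ c))))))) (x≼ hx)) (x≼ hy)) (x≼ hz)) (x≼ hw)

  +0 : ∀ {x y} → x ≤ K → y ≤ K → Γ ⊢ (num x `× num y) `+ `0 ≐ num x `× num y
  +0 {x} hx hy = inst-∀≤ (num x ∷ₛ var) (var (# 1)) +0-clause
    (inst-∀≤ var v (∀≤ (var (# 1)) +0-clause) (subF-var _ (∧E₁ (∧E₂ (∧E₂ (∧E₂ (∧E₂ (∧E₂ (∧E₂ c))))))))
             (x≼ hx)) (x≼ hy)

  +S : ∀ {x y z} → x ≤ K → y ≤ K → z ≤ K → Γ ⊢ (num x `× num y) `+ `S (num z) ≐ `S ((num x `× num y) `+ num z)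
  +S {x} {y} hx hy hz = inst-∀≤ (num y ∷ₛ num x ∷ₛ var) (var (# 2)) +S-clause
    (inst-∀≤ (num x ∷ₛ var) (var (# 1)) (∀≤ (var (# 2)) +S-clause)
      (inst-∀≤ var v (∀≤ (var (# 1)) (∀≤ (var (# 2)) +S-clause))
        (subF-var _ (∧E₁ (∧E₂ (∧E₂ (∧E₂ (∧E₂ (∧E₂ (∧E₂ (∧E₂ c))))))))) (x≼ hx)) (x≼ hy)) (x≼ hz)

  ×0 : ∀ {x} → x ≤ K → Γ ⊢ num x `× `0 ≐ `0
  ×0 hx = inst-∀≤ var v ×0-clause (subF-var _ (∧E₁ (∧E₂ (∧E₂ (∧E₂ (∧E₂ (∧E₂ (∧E₂ (∧E₂ (∧E₂ c)))))))))) (x≼ hx)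

  ×S : ∀ {x y} → x ≤ K → y ≤ K → Γ ⊢ num x `× `S (num y) ≐ (num x `× num y) `+ num x
  ×S {x} hx hy = inst-∀≤ (num x ∷ₛ var) (var (# 1)) ×S-clause
    (inst-∀≤ var v (∀≤ (var (# 1)) ×S-clause) (subF-var _ (∧E₂ (∧E₂ (∧E₂ (∧E₂ (∧E₂ (∧E₂ (∧E₂ (∧E₂ (∧E₂ c))))))))))
             (x≼ hx)) (x≼ hy)

  private
    ≤K : ∀ {a} → suc a ≤ K → a ≤ K
    ≤K {a} = ≤-trans (n≤1+n a)

    ≐num-cast : ∀ {A a b} → a ≡ b → Γ ⊢ A ≐ num a → Γ ⊢ A ≐ num b
    ≐num-cast refl d = d

  ×-value : ∀ {x y} → x ≤ K → y ≤ K → Γ ⊢ num x `× num y ≐ num (x * y)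
  ×+-value : ∀ {x y z} → x ≤ K → y ≤ K → z ≤ K → Γ ⊢ (num x `× num y) `+ num z ≐ num (x * y + z)
  ×-value {x} {zero}  hx hy = ≐num-cast (sym (*-zeroʳ x)) (×0 hx)
  ×-value {x} {suc y} hx hy =
    ≐-trans (×S hx (≤K hy)) (≐num-cast (trans (+-comm (x * y) x) (sym (*-suc x y))) (×+-value hx (≤K hy) hx))
  ×+-value {x} {y} {zero}  hx hy hz = ≐-trans (+0 hx hy) (≐num-cast (sym (+-identityʳ (x * y))) (×-value hx hy))
  ×+-value {x} {y} {suc z} hx hy hz =
    ≐-trans (+S hx hy (≤K hz)) (≐num-cast (sym (+-suc (x * y) z)) (≐-congS (×+-value hx hy (≤K hz))))

  ×-apart : ∀ {x y l} → x ≤ K → y ≤ K → l ≤ K → x * y ≢ l → Γ ⊢ ¬' (num x `× num y ≐ num l)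
  ×+-apart : ∀ {x y z l} → x ≤ K → y ≤ K → z ≤ K → l ≤ K → x * y + z ≢ l →
             Γ ⊢ ¬' ((num x `× num y) `+ num z ≐ num l)
  ×-apart {x} {zero} {zero} hx hy hl ne = ⊥-elim (ne (*-zeroʳ x))
  ×-apart {x} {zero} {suc l} hx hy hl ne =
    ⇒I (⇒E (weaken₁ (S≢0 z≤n z≤n (≤K hl)))
           (≐-trans (weaken₁ (≐-congS (×+-value z≤n z≤n (≤K hl))))
                    (≐-trans (≐-sym (hyp (here refl))) (weaken₁ (×0 hx)))))
  ×-apart {x} {suc y} {l} hx hy hl ne =
    ⇒I (⇒E (weaken₁ (×+-apart hx (≤K hy) hx hl
                               (λ eq → ne (trans (sym (trans (+-comm (x * y) x) (sym (*-suc x y)))) eq))))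
           (≐-trans (≐-sym (weaken₁ (×S hx (≤K hy)))) (hyp (here refl))))
  ×+-apart {x} {y} {zero} hx hy hz hl ne =
    ⇒I (⇒E (weaken₁ (×-apart hx hy hl (λ eq → ne (trans (+-identityʳ (x * y)) eq))))
           (≐-trans (≐-sym (weaken₁ (+0 hx hy))) (hyp (here refl))))
  ×+-apart {x} {y} {suc z} {zero} hx hy hz hl ne =
    ⇒I (⇒E (weaken₁ (S≢0 hx hy (≤K hz))) (≐-trans (≐-sym (weaken₁ (+S hx hy (≤K hz)))) (hyp (here refl))))
  ×+-apart {x} {y} {suc z} {suc l} hx hy hz hl ne =
    ⇒I (⇒E (weaken₁ (×+-apart hx hy (≤K hz) (≤K hl) (λ eq → ne (trans (+-suc (x * y) z) (cong suc eq)))))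
           (⇒E (weaken₁ (S-inj hx hy (≤K hz) (≤K hl)))
               (≐-trans (≐-sym (weaken₁ (+S hx hy (≤K hz)))) (hyp (here refl)))))

  -- Every small numeral a is provably 0 × 0 + a, which reduces the remaining
  -- atomic facts to those about x × y + z.
  0×0+ : ∀ {a} → a ≤ K → Γ ⊢ num a ≐ (num 0 `× num 0) `+ num a
  0×0+ ha = ≐-sym (×+-value z≤n z≤n ha)

  numerals-apart : ∀ a b → a ≤ K → b ≤ K → a ≢ b → Γ ⊢ ¬' (num a ≐ num b)
  numerals-apart a b ha hb ne = ⇒I (⇒E (weaken₁ (×+-apart z≤n z≤n ha hb ne))
                              (≐-trans (≐-sym (weaken₁ (0×0+ ha))) (hyp (here refl))))

  S-apart : ∀ a b → a ≤ K → b ≤ K → suc a ≢ b → Γ ⊢ ¬' (`S (num a) ≐ num b)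
  S-apart a zero ha hb ne =
    ⇒I (⇒E (weaken₁ (S≢0 z≤n z≤n ha)) (≐-trans (≐-sym (weaken₁ (≐-congS (0×0+ ha)))) (hyp (here refl))))
  S-apart a (suc b) ha hb ne =
    ⇒I (⇒E (weaken₁ (×+-apart z≤n z≤n ha (≤K hb) (λ eq → ne (cong suc eq))))
           (⇒E (weaken₁ (S-inj z≤n z≤n ha (≤K hb)))
               (≐-trans (≐-sym (weaken₁ (≐-congS (0×0+ ha)))) (hyp (here refl)))))

  -- a + b is treated as (a × 1) + b, or as (0 × 0) + b when a = 0.
  as-product : ∀ a → a ≤ K → ∃[ x ] ∃[ y ] (x ≤ K × y ≤ K × x * y ≡ a × (Γ ⊢ num a ≐ num x `× num y))
  as-product zero    ha = 0 , 0 , z≤n , z≤n , refl , ≐-sym (×0 z≤n)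
  as-product (suc a) ha = suc a , 1 , ha , ≤-trans (s≤s z≤n) ha , *-identityʳ (suc a) ,
                          ≐-sym (≐num-cast (*-identityʳ (suc a)) (×-value ha (≤-trans (s≤s z≤n) ha)))

  +-value : ∀ a b → a ≤ K → b ≤ K → Γ ⊢ num a `+ num b ≐ num (a + b)
  +-value a b ha hb with as-product a ha
  ... | x , y , hx , hy , xy≡a , d =
    ≐-trans (≐-cong+ d (≐refl _)) (≐num-cast (cong (_+ b) xy≡a) (×+-value hx hy hb))

  +-apart : ∀ a b c → a ≤ K → b ≤ K → c ≤ K → a + b ≢ c → Γ ⊢ ¬' (num a `+ num b ≐ num c)
  +-apart a b c ha hb hc ne with as-product a ha
  ... | x , y , hx , hy , xy≡a , d =
    ⇒I (⇒E (weaken₁ (×+-apart hx hy hb hc (λ eq → ne (trans (cong (_+ b) (sym xy≡a)) eq))))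
           (≐-trans (weaken₁ (≐-cong+ (≐-sym d) (≐refl _))) (hyp (here refl))))

  private
    zero-minimal : Γ ⊢ zeroMinimal
    zero-minimal = ∧E₁ (∧E₂ (∧E₂ c))

    ≼-split : Γ ⊢ ∀< (var zero) (∀' ≼S-split)
    ≼-split = ∧E₁ (∧E₂ (∧E₂ (∧E₂ c)))

    below : ∀ y → y < K → Γ ⊢ num y ≺ var zero
    below y y< = ∧I (≼-var atLeast y (<⇒≤ y<)) (≢-var atLeast y y<)

  open Ordering zero zero-minimal ≼-split K below public using (≼-numerals; ⋠-numerals)

  leAxiom-derivable : ∀ j → j ≤ K → Γ ⊢ leAxiom j
  leAxiom-derivable j j≤ =
    ∀I (Ordering.≼num⇒isNum≤ (suc zero) (weakenVar zero-minimal) (weakenVar ≼-split) K below′ (var zero) j j≤)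
    where
    below′ : ∀ y → y < K → map wkF Γ ⊢ num y ≺ var (suc zero)
    below′ y y< = retype (cong (_≺ var (suc zero)) (renT-num suc y)) (weakenVar (below y y<))

  arith : ArithUpTo Γ K
  arith = record
    { plus  = λ i j → +-value i j
    ; times = λ i j → ×-value
    ; apart = numerals-apart
    ; leAx  = leAxiom-derivable
    ; le    = ≼-numerals
    }

  varBoundFacts : ∀ {n} (i : Fin n) e → e i ≤ K → BoundFacts Γ (var i) e
  varBoundFacts i e ei≤ = record
    { value    = ≐refl _
    ; le-axiom = leAxiom-derivable (e i) ei≤
    ; below    = λ c c≤ → ≼-numerals c (e i) c≤ ei≤
    ; distinct = λ c c< → numerals-apart c (e i) (≤-trans (<⇒≤ c<) ei≤) ei≤ (λ eq → <-irrefl eq c<)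
    }

  private
    ≤K-∷ : ∀ {n} {e : Fin n → ℕ} {k} → k ≤ K → (∀ i → e i ≤ K) → ∀ i → (k ∷ₑ e) i ≤ K
    ≤K-∷ k≤ h zero    = k≤
    ≤K-∷ k≤ h (suc i) = h i

  decisive-pure : ∀ {n} {φ : Formula n} (p : PureΔ₀ φ) e → (∀ i → e i ≤ K) → Decisive Γ (pure⇒bounded p) e
  decisive-pure p⊥ e h = tt
  decisive-pure (p≼ i j) e h with e i ≤? e j
  ... | yes ≤ = inj₁ (≤ , ≼-numerals _ _ ≤ (h j))
  ... | no ≰ = inj₂ (≰ , ⋠-numerals _ _ (≰⇒> ≰) (h j)
                        (λ c c≤ → numerals-apart _ c (h i) (≤-trans c≤ (h j))
                                                   (λ eq → ≰ (subst (_≤ e j) (sym eq) c≤))))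
  decisive-pure (p≐ i j) e h with e i ≟ e j
  ... | yes eq = inj₁ (eq , subst (λ k → Γ ⊢ num (e i) ≐ num k) eq (≐refl _))
  ... | no ne  = inj₂ (ne , numerals-apart _ _ (h i) (h j) ne)
  decisive-pure (p0 i) e h with 0 ≟ e i
  ... | yes eq = inj₁ (eq , subst (λ k → Γ ⊢ `0 ≐ num k) eq (≐refl _))
  ... | no ne  = inj₂ (ne , numerals-apart 0 _ z≤n (h i) ne)
  decisive-pure (pS i j) e h with suc (e i) ≟ e j
  ... | yes eq = inj₁ (eq , subst (λ k → Γ ⊢ num (suc (e i)) ≐ num k) eq (≐refl _))
  ... | no ne  = inj₂ (ne , S-apart _ _ (h i) (h j) ne)
  decisive-pure (p+ i j k) e h with e i + e j ≟ e k
  ... | yes eq = inj₁ (eq , ≐num-cast eq (+-value _ _ (h i) (h j)))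
  ... | no ne  = inj₂ (ne , +-apart _ _ _ (h i) (h j) (h k) ne)
  decisive-pure (p× i j k) e h with e i * e j ≟ e k
  ... | yes eq = inj₁ (eq , ≐num-cast eq (×-value (h i) (h j)))
  ... | no ne  = inj₂ (ne , ×-apart (h i) (h j) (h k) ne)
  decisive-pure (p⇒ p q) e h = decisive-pure p e h , decisive-pure q e h
  decisive-pure (p∧ p q) e h = decisive-pure p e h , decisive-pure q e h
  decisive-pure (p∨ p q) e h = decisive-pure p e h , decisive-pure q e h
  decisive-pure (p∀≤ i p) e h =
    varBoundFacts i e (h i) , λ k k≤ → decisive-pure p (k ∷ₑ e) (≤K-∷ (≤-trans k≤ (h i)) h)
  decisive-pure (p∃≤ i p) e h =
    varBoundFacts i e (h i) , λ k k≤ → decisive-pure p (k ∷ₑ e) (≤K-∷ (≤-trans k≤ (h i)) h)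
  decisive-pure (p∀< i p) e h =
    varBoundFacts i e (h i) , λ k k< → decisive-pure p (k ∷ₑ e) (≤K-∷ (≤-trans (<⇒≤ k<) (h i)) h)
  decisive-pure (p∃< i p) e h =
    varBoundFacts i e (h i) , λ k k< → decisive-pure p (k ∷ₑ e) (≤K-∷ (≤-trans (<⇒≤ k<) (h i)) h)

-- Inconsistency of [ρ]

record Refutation (X : Formula 0) : Set where
  field
    isΣ₁   : IsΣ₁ X
    false  : ¬ ℕ⊨ X
    bound  : ℕ
    refute : ∀ {Γ : List (Formula 1)} → ArithUpTo Γ bound → Γ ⊢ wkF X → Γ ⊢ ⊥'

R₀-false-transfer : ∀ {ρ X} → IsΣ₁ ρ → IsΣ₁ X → R₀ ⊢ᵀ (ρ ⇔' X) → ¬ ℕ⊨ X → ¬ ℕ⊨ ρ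
R₀-false-transfer isΣρ isΣX (Γ , axioms , d) ¬X ρ =
  Σ₁-satᶜ⇒¬¬sat isΣX noEnv (proj₁ (soundness d noEnv models) (Σ₁-sat⇒satᶜ isΣρ noEnv ρ)) ¬X
  where
  models : Models noEnv Γ
  models p = R₀-sound (proj₁ (axiom-within axioms p))

certified-inconsistent : ∀ {ρ ρ₀ X} → IsΣ₁ ρ → IsBullet ρ ρ₀ → R₀ ⊢ᵀ (ρ ⇔' X) → Refutation X →
                         Inconsistent [ ρ₀ ]ᶜ
certified-inconsistent {ρ} {ρ₀} {X} isΣρ (pure , _ , ∃ρ₀⇒ρ , ⊢∃ρ₀⇒ρ) (Γᴿ , axioms , ⊢ρ⇔X) refutation =
  ∃E (hyp (here refl))
     (numeral-cases (suc N) (cert-zero≼ (∧E₁ (hyp (here refl)))) (cert-successorClosed (∧E₁ (hyp (here refl))))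
                    numeral large)
  where
  open Refutation refutation

  N : ℕ
  N = axiomsBound axioms ⊔ bound

  no-witness : ∀ k → ¬ sat (k ∷ₑ noEnv) ρ₀
  no-witness k ρ₀k = R₀-false-transfer isΣρ isΣ₁ (Γᴿ , axioms , ⊢ρ⇔X) false (∃ρ₀⇒ρ (k , ρ₀k))

  Γ₁ : List (Formula 1)
  Γ₁ = (cert ∧' ρ₀) ∷ map wkF ([ ρ₀ ]ᶜ ∷ [])

  ρ₀-var : ρ₀ ⟨ var zero ⟩ ≡ ρ₀
  ρ₀-var = subF-id (λ { zero → refl }) ρ₀

  numeral : ∀ {Δ} k → k < suc N → Γ₁ ⊆ Δ → AtLeast Δ k → Δ ⊢ num k ≐ var zero → Δ ⊢ ⊥'
  numeral k _ Γ₁⊆Δ atLeast k≐x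
    with decide (pure⇒bounded pure) (k ∷ₑ noEnv)
                (Cert.decisive-pure (weaken Γ₁⊆Δ (∧E₁ (hyp (here refl)))) atLeast pure _ λ { zero → ≤-refl })
  ... | inj₁ (ρ₀k , _) = ⊥-elim (no-witness k ρ₀k)
  ... | inj₂ (_ , ⊢¬ρ₀k) =
    ⇒E ⊢¬ρ₀k (retype (sym (⌜⌝-⟨⟩ ρ₀ k))
                (⟨⟩-transport ρ₀ (≐-sym k≐x) (retype (sym ρ₀-var) (weaken Γ₁⊆Δ (∧E₂ (hyp (here refl)))))))

  large : ∀ {Δ} → Γ₁ ⊆ Δ → AtLeast Δ (suc N) → Δ ⊢ ⊥'
  large {Δ} Γ₁⊆Δ atLeast = refute (ArithUpTo-mono (≤-trans (m≤n⊔m _ bound) (n≤1+n N)) A) ⊢X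
    where
    A : ArithUpTo Δ (suc N)
    A = Cert.arith (weaken Γ₁⊆Δ (∧E₁ (hyp (here refl)))) atLeast
    ⊢ρ : Δ ⊢ wkF ρ
    ⊢ρ = ⇒E (weaken (λ ()) (weakenVar ⊢∃ρ₀⇒ρ))
            (∃I (var zero) (retype (sym (trans (subF-renF (λ { zero → refl }) ρ₀) ρ₀-var))
                                   (weaken Γ₁⊆Δ (∧E₂ (hyp (here refl))))))
    axiom : ∀ {ψ} → ψ ∈ map wkF Γᴿ → Δ ⊢ ψ
    axiom p with ∈-map⁻ wkF p
    ... | _ , q , refl with axiom-within axioms q
    ... | r , r≤ = R₀-axiom-from-arith A r (≤-trans r≤ (≤-trans (m≤m⊔n _ bound) (n≤1+n N)))
    ⊢X : Δ ⊢ wkF X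
    ⊢X = ⇒E (∧E₁ (cut (map wkF Γᴿ) axiom (weakenVar ⊢ρ⇔X))) ⊢ρ

-- Comparisons of Σ₁-sentences

module Comparison (σ₀ σ₀′ : Formula 1) (bσ : Bounded σ₀) (bσ₀′ : Bounded σ₀′) where

  σ′ : Formula 1
  σ′ = wb ∧' σ₀′

  wb-bounded : Bounded wb
  wb-bounded = b∧ (b≼ `0 (var zero)) (b∀< (var zero) (b≼ (`S (var zero)) (var (suc zero))))

  bσ′ : Bounded σ′
  bσ′ = b∧ wb-bounded bσ₀′

  comparisonBound : ℕ → ℕ
  comparisonBound n = formulaBound bσ (n ∷ₑ noEnv) ⊔ max≤ (λ k → formulaBound bσ′ (k ∷ₑ noEnv)) n

  σ₀-inner-[] : ∀ k → renF (liftR (liftR suc)) (inner σ₀) [ num k ] ≡ σ₀ ⟨ num {2} k ⟩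
  σ₀-inner-[] k = trans (cong (subF (sub0 (num k))) (renF-renF {r = λ { zero → zero }} (λ { zero → refl }) σ₀))
                        (subF-renF (λ { zero → refl }) σ₀)

  -- A witness y of σ′ cannot be a numeral below m (none is a witness in ℕ),
  -- and Z refutes it once it is at least m.
  refute-before : ∀ (Z : Formula 1) n m → m ≤ suc n → sat (n ∷ₑ noEnv) σ₀ →
    (∀ k → k < m → ¬ sat (k ∷ₑ noEnv) σ′) →
    (∀ {Δ : List (Formula 2)} → Δ ⊢ renF (liftR suc) Z → AtLeast Δ m →
       Δ ⊢ (¬' renF (liftR (liftR suc)) (inner σ₀)) [ num n ]) →
    ∀ {Γ : List (Formula 1)} → ArithUpTo Γ (comparisonBound n) → Γ ⊢ wkF (∃' (σ′ ∧' Z)) → Γ ⊢ ⊥'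
  refute-before Z n m m≤ σn below Z-refutes {Γ} A d =
    ∃E d (numeral-cases m (∧E₁ (∧E₁ (∧E₁ (hyp (here refl))))) (∧E₂ (∧E₁ (∧E₁ (hyp (here refl))))) numeral above)
    where
    Γ₂ : List (Formula 2)
    Γ₂ = renF (liftR suc) (σ′ ∧' Z) ∷ map wkF Γ
    A₂ : ArithUpTo Γ₂ (comparisonBound n)
    A₂ = ArithUpTo-weaken (xs⊆x∷xs _ _) (ArithUpTo-rename suc A)

    ⊢σ′y : Γ₂ ⊢ σ′ ⟨ var zero ⟩
    ⊢σ′y = retype (trans (renF-as-subF _ σ′) (subF-cong (λ { zero → refl }) σ′)) (∧E₁ (hyp (here refl)))

    numeral : ∀ {Δ} j → j < m → Γ₂ ⊆ Δ → AtLeast Δ j → Δ ⊢ num j ≐ var zero → Δ ⊢ ⊥'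
    numeral j j< Γ₂⊆Δ _ j≐y with FromArith.decides A₂ bσ′ (j ∷ₑ noEnv)
      (≤-trans (≤max≤ (λ k → formulaBound bσ′ (k ∷ₑ noEnv)) n (≤-pred (≤-trans j< m≤))) (m≤n⊔m _ _))
    ... | inj₁ (σ′j , _) = ⊥-elim (below j j< σ′j)
    ... | inj₂ (_ , ⊢¬σ′j) = ⇒E (weaken Γ₂⊆Δ (retype (cong ¬'_ (⌜⌝-⟨⟩ σ′ j)) ⊢¬σ′j))
                                 (⟨⟩-transport σ′ (≐-sym j≐y) (weaken Γ₂⊆Δ ⊢σ′y))

    ⊢σn : Γ₂ ⊢ σ₀ ⟨ num n ⟩
    ⊢σn with FromArith.decides A₂ bσ (n ∷ₑ noEnv) (m≤m⊔n _ _)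
    ... | inj₁ (_ , d) = retype (⌜⌝-⟨⟩ σ₀ n) d
    ... | inj₂ (¬σn , _) = ⊥-elim (¬σn σn)

    above : ∀ {Δ} → Γ₂ ⊆ Δ → AtLeast Δ m → Δ ⊢ ⊥'
    above Γ₂⊆Δ atLeast =
      ⇒E (retype (cong ¬'_ (σ₀-inner-[] n)) (Z-refutes (weaken Γ₂⊆Δ (∧E₂ (hyp (here refl)))) atLeast))
         (weaken Γ₂⊆Δ ⊢σn)

  <ˢ-refutation : ∀ n → sat (n ∷ₑ noEnv) σ₀ → (∀ k → k < n → ¬ sat (k ∷ₑ noEnv) σ′) → Refutation (σ′ <ˢ σ₀)
  <ˢ-refutation n σn below = record
    { isΣ₁   = σ∃ (σbnd (b∧ bσ′ (b∀≤ (var zero) (b⇒ (Bounded-renF _ bσ) b⊥))))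
    ; false  = λ (y , σ′y , none≤y) → case y σ′y none≤y
    ; bound  = comparisonBound n
    ; refute = refute-before (∀≤ (var zero) (¬' inner σ₀)) n n (n≤1+n n) σn below
                 (λ Z atLeast → ⇒E (∀E Z (num n)) (≼-var atLeast n ≤-refl))
    }
    where
    case : ∀ y → sat (y ∷ₑ noEnv) σ′ → sat (y ∷ₑ noEnv) (∀≤ (var zero) (¬' inner σ₀)) → ⊥
    case y σ′y none≤y with n ≤? y
    ... | yes n≤y = none≤y n n≤y (from (sat-inner σ₀ n y) σn)
    ... | no n≰y  = below y (≰⇒> n≰y) σ′y

  ≤ˢ-refutation : ∀ n → sat (n ∷ₑ noEnv) σ₀ → (∀ k → k ≤ n → ¬ sat (k ∷ₑ noEnv) σ′) → Refutation (σ′ ≤ˢ σ₀)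
  ≤ˢ-refutation n σn below = record
    { isΣ₁   = σ∃ (σbnd (b∧ bσ′ (b∀< (var zero) (b⇒ (Bounded-renF _ bσ) b⊥))))
    ; false  = λ (y , σ′y , none<y) → case y σ′y none<y
    ; bound  = comparisonBound n
    ; refute = refute-before (∀< (var zero) (¬' inner σ₀)) n (suc n) ≤-refl σn (λ k k< → below k (≤-pred k<))
                 (λ Z atLeast → ⇒E (∀E Z (num n)) (∧I (≼-var atLeast n (n≤1+n n)) (≢-var atLeast n ≤-refl)))
    }
    where
    case : ∀ y → sat (y ∷ₑ noEnv) σ′ → sat (y ∷ₑ noEnv) (∀< (var zero) (¬' inner σ₀)) → ⊥
    case y σ′y none<y with y ≤? n
    ... | yes y≤n = below y y≤n σ′y
    ... | no y≰n  = none<y n (<⇒≤ (≰⇒> y≰n) , λ n≡y → y≰n (≤-reflexive (sym n≡y))) (from (sat-inner σ₀ n y) σn)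

theorem6p4 : (σ₀ σ₀' : Formula 1) → Bounded σ₀ → Bounded σ₀' →
    (ρ : Formula 0) → IsΣ₁ ρ →
    (ρ₀ : Formula 1) → IsBullet ρ ρ₀ →
      (ℕ⊨ (σ₀ ≤ˢ (wb ∧' σ₀')) → R₀ ⊢ᵀ (ρ ⇔' ((wb ∧' σ₀') <ˢ σ₀)) →
         Inconsistent [ ρ₀ ]ᶜ)
      × (ℕ⊨ (σ₀ <ˢ (wb ∧' σ₀')) → R₀ ⊢ᵀ (ρ ⇔' ((wb ∧' σ₀') ≤ˢ σ₀)) →
         Inconsistent [ ρ₀ ]ᶜ)
theorem6p4 σ₀ σ₀' bσ bσ' ρ isΣρ ρ₀ bullet = part-a , part-b
  where
  open Comparison σ₀ σ₀' bσ bσ'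
  part-a : ℕ⊨ (σ₀ ≤ˢ σ′) → R₀ ⊢ᵀ (ρ ⇔' (σ′ <ˢ σ₀)) → Inconsistent [ ρ₀ ]ᶜ
  part-a (n , σn , none<n) ρ⇔ = certified-inconsistent isΣρ bullet ρ⇔ (<ˢ-refutation n σn
    λ k k<n σ′k → none<n k (from (sat-≺-bound k (n ∷ₑ noEnv) (var zero)) k<n) (from (sat-inner σ′ k n) σ′k))
  part-b : ℕ⊨ (σ₀ <ˢ σ′) → R₀ ⊢ᵀ (ρ ⇔' (σ′ ≤ˢ σ₀)) → Inconsistent [ ρ₀ ]ᶜ
  part-b (n , σn , none≤n) ρ⇔ = certified-inconsistent isΣρ bullet ρ⇔ (≤ˢ-refutation n σn
    λ k k≤n σ′k → none≤n k k≤n (from (sat-inner σ′ k n) σ′k))
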